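{- Let $\lambda$ be a partition, $x\in\lambda$ an outer corner, $\mu=\lambda\setminus\{x\}$, $\pi\in\mathrm{RPP}_{\lambda,x}$, $\rho=\zeta_{\lambda,x}(\pi)$, and $v\in\lambda$ a cell. Regard $\mathrm{cand}(\pi)$ (computed in $\lambda$) and $\mathrm{cand}(\rho)$ (computed in $\mu$) as ordered by the content order. (i) If $c(v)\notin\{c(x)-1,c(x),c(x)+1\}$, then $v\in\mathrm{cand}(\pi)$ if and only if $v\in\mathrm{cand}(\rho)$. (ii) Let $c(v)=c(x)$ and let $v$ be the minimum of $\mathrm{cand}(\pi)$. If $\pi(v)=\pi(\mathrm n v)$ then $\mathrm n v\in\mathrm{cand}(\rho)$ and $\mathrm e v\notin\mathrm{cand}(\rho)$. If $\pi(v)>\pi(\mathrm n v)$ then $\mathrm e v\in\mathrm{cand}(\rho)$. (iii) Let $c(v)=c(x)+1$ and let $v$ be the minimum of $\mathrm{cand}(\rho)$. If $\rho(v)\le\rho(\mathrm s\mathrm w v)$ then $\mathrm w v\in\mathrm{cand}(\pi)$ and $\mathrm s v\notin\mathrm{cand}(\pi)$. If $\rho(v)>\rho(\mathrm s\mathrm w v)$ then $\mathrm s v\in\mathrm{cand}(\pi)$. (iv) Let $c(v)=c(x)-1$. Then $v\in\mathrm{cand}(\pi)$ implies $v\in\mathrm{cand}(\rho)$, and if $v$ is the minimum of $\mathrm{cand}(\rho)$ then $v\in\mathrm{cand}(\pi)$.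
   Context: Cells are pairs $(i,j)\in\mathbb Z^2$; $\mathrm n(i,j)=(i-1,j)$, $\mathrm e(i,j)=(i,j+1)$, $\mathrm s(i,j)=(i+1,j)$, $\mathrm w(i,j)=(i,j-1)$. A partition $\lambda$ is identified with its Young diagram. A reverse plane partition of shape $\lambda$ is $\pi:\lambda\to\mathbb N$ with $\pi(u)\le\pi(\mathrm e u),\pi(\mathrm s u)$, with conventions $\pi(i,j)=0$ if $i\le0$ or $j\le0$, $\pi(i,j)=\infty$ if $i,j\ge1$, $(i,j)\notin\lambda$; $\mathrm{RPP}_\lambda$ is the set of them. Content $c(i,j)=j-i$. For a partition $\nu$: outer corner: $u\in\nu$ with $\mathrm e u,\mathrm s u\notin\nu$; inner corner: $\mathrm e u,\mathrm s u\in\nu$, $\mathrm e\mathrm s u\notin\nu$. With inner corner contents $i_1<\dots<i_r$ and outer corner contents $o_1<\dots<o_{r+1}$ of $\nu$ (interlacing), $\mathcal O_\nu=\{u\in\nu:c(u)=o_k\text{ some }k\}$ and $\mathcal A_\nu=\{u\in\nu:c(u)<o_1\text{ or }i_k<c(u)<o_{k+1}\text{ for some }k\in[r]\}$. For a reverse plane partition $\pi$ of shape $\nu$, $\mathrm{cand}(\pi)=\{u\in\mathcal O_\nu:\pi(u)>\pi(\mathrm w u)\}\cup\{u\in\mathcal A_\nu:\pi(u)>\pi(\mathrm w u),\pi(u)>\pi(\mathrm n u)\}$. Content order: $(i,j)\trianglelefteq(k,l)$ iff $j-i>l-k$, or $j-i=l-k$ and $i\ge k$. For an outer corner $x$ of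 $\lambda$ and $\mu=\lambda\setminus\{x\}$, define $\zeta_{\lambda,x}:\mathrm{RPP}_\lambda\to\mathrm{RPP}_\mu$ by $\zeta_{\lambda,x}(\pi)(u)=\max\{\pi(\mathrm n u),\pi(\mathrm w u)\}+\min\{\pi(\mathrm e u),\pi(\mathrm s u)\}-\pi(u)$ if $c(u)=c(x)$, and $\zeta_{\lambda,x}(\pi)(u)=\pi(u)$ otherwise ($u\in\mu$). Set $\mathrm{RPP}_{\lambda,x}=\{\pi\in\mathrm{RPP}_\lambda:\pi(x)=\max\{\pi(\mathrm n x),\pi(\mathrm w x)\}\}$. Values of $\rho$ at cells outside $\mu$ follow the conventions for shape $\mu$. -}

module Defs where

open import Data.Bool using (Bool; true; false; _∧_; not; if_then_else_; T)
open import Data.Nat as ℕ using (ℕ; zero; suc)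
open import Data.Integer as ℤ using (ℤ; +_; -[1+_]; _-_; _+_; _≤ᵇ_; 1ℤ)
open import Data.Integer.Properties using (≤-decTotalOrder)
open import Data.List using (List; []; _∷_; _++_; map; upTo; filterᵇ)
open import Data.List.Relation.Unary.Linked using (Linked)
open import Data.Maybe using (Maybe; just; nothing)
open import Data.Product using (_×_; _,_; Σ; ∃; ∃-syntax)
open import Data.Sum using (_⊎_)
open import Relation.Binary.PropositionalEquality using (_≡_; _≢_)
open import Relation.Nullary using (¬_; yes; no)
open import Data.List.Sort.InsertionSort.Base ≤-decTotalOrder using (sort)

Cell : Set
Cell = ℤ × ℤ

n w e s : Cell → Cell
n (i , j) = (i - 1ℤ , j)
e (i , j) = (i , j + 1ℤ)
s (i , j) = (i + 1ℤ , j)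
w (i , j) = (i , j - 1ℤ)

c : Cell → ℤ
c (i , j) = j - i

-- Partitions: a list of row lengths λ₁ ≥ λ₂ ≥ … (trailing zeros allowed,
-- they do not change the Young diagram).

IsPartition : List ℕ → Set
IsPartition = Linked (λ a b → b ℕ.≤ a)

-- length of row i (rows are indexed from 1; 0 outside)
rowLenℕ : List ℕ → ℕ → ℕ
rowLenℕ []       _       = 0
rowLenℕ (r ∷ rs) zero    = r
rowLenℕ (r ∷ rs) (suc k) = rowLenℕ rs k

rowLen : List ℕ → ℤ → ℕ
rowLen ν (+ zero)  = 0
rowLen ν (+ suc k) = rowLenℕ ν k
rowLen ν -[1+ _ ]  = 0

memᵇ : List ℕ → Cell → Bool
memᵇ ν (i , j) = (1ℤ ≤ᵇ i) ∧ ((1ℤ ≤ᵇ j) ∧ (j ≤ᵇ + rowLen ν i))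

infix 4 _∈ᵈ_
_∈ᵈ_ : Cell → List ℕ → Set
u ∈ᵈ ν = T (memᵇ ν u)

cellsFrom : ℕ → List ℕ → List Cell
cellsFrom i []       = []
cellsFrom i (r ∷ rs) = map (λ j → (+ suc i , + suc j)) (upTo r) ++ cellsFrom (suc i) rs

cells : List ℕ → List Cell
cells = cellsFrom 0

isOuterᵇ : List ℕ → Cell → Bool
isOuterᵇ ν u = memᵇ ν u ∧ (not (memᵇ ν (e u)) ∧ not (memᵇ ν (s u)))

OuterCorner : List ℕ → Cell → Set
OuterCorner ν u = T (isOuterᵇ ν u)

-- inner corner: e u ∈ ν, s u ∈ ν, e s u ∉ ν  (such u automatically lie in ν)
isInnerᵇ : List ℕ → Cell → Bool
isInnerᵇ ν u = memᵇ ν (e u) ∧ (memᵇ ν (s u) ∧ not (memᵇ ν (e (s u))))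

InnerCorner : List ℕ → Cell → Set
InnerCorner ν u = T (isInnerᵇ ν u)

-- o₁ < … < o_{r+1}  and  i₁ < … < i_r  as sorted lists
outerContents : List ℕ → List ℤ
outerContents ν = sort (map c (filterᵇ (isOuterᵇ ν) (cells ν)))

innerContents : List ℕ → List ℤ
innerContents ν = sort (map c (filterᵇ (isInnerᵇ ν) (cells ν)))

-- 0-based indexing into a list
nth : List ℤ → ℕ → Maybe ℤ
nth []       _       = nothing
nth (x ∷ xs) zero    = just x
nth (x ∷ xs) (suc k) = nth xs k

InO : List ℕ → Cell → Set
InO ν u = u ∈ᵈ ν × ∃[ o ] (∃[ k ] (nth (outerContents ν) k ≡ just o) × c u ≡ o)

-- 𝒜_ν : c(u) < o₁, or i_k < c(u) < o_{k+1} for some k ∈ [r]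
--   (with 0-based k: i_{k+1} = nth inner k, o_{k+2} = nth outer (suc k))
InA : List ℕ → Cell → Set
InA ν u = u ∈ᵈ ν ×
  ( (∃[ o₁ ] (nth (outerContents ν) 0 ≡ just o₁ × c u ℤ.< o₁))
  ⊎ (∃[ k ] ∃[ a ] ∃[ b ] (nth (innerContents ν) k ≡ just a
                          × nth (outerContents ν) (suc k) ≡ just b
                          × a ℤ.< c u × c u ℤ.< b)) )

-- Extended naturals ℕ ∪ {∞} for the boundary conventions

data ℕ∞ : Set where
  fin : ℕ → ℕ∞
  ∞   : ℕ∞

infix 4 _≤∞_ _<∞_
data _≤∞_ : ℕ∞ → ℕ∞ → Set where
  fin≤fin : ∀ {a b} → a ℕ.≤ b → fin a ≤∞ fin b
  _≤∞∞    : ∀ x → x ≤∞ ∞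

data _<∞_ : ℕ∞ → ℕ∞ → Set where
  fin<fin : ∀ {a b} → a ℕ.< b → fin a <∞ fin b
  fin<∞   : ∀ a → fin a <∞ ∞

max∞ min∞ : ℕ∞ → ℕ∞ → ℕ∞
max∞ (fin a) (fin b) = fin (a ℕ.⊔ b)
max∞ _       _       = ∞
min∞ (fin a) (fin b) = fin (a ℕ.⊓ b)
min∞ (fin a) ∞       = fin a
min∞ ∞       y       = y

-- (only ever applied to finite values in ζ; ∞ ↦ 0 is junk)
unfin : ℕ∞ → ℕ
unfin (fin a) = a
unfin ∞       = 0

-- Fillings. A filling is a function Cell → ℕ; only its values on cells
-- of the shape matter, the value at other cells is given by the
-- conventions via `val`.

Filling : Set
Filling = Cell → ℕ

val : List ℕ → Filling → Cell → ℕ∞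
val ν π (i , j) =
  if (i ≤ᵇ + 0) then fin 0 else
  if (j ≤ᵇ + 0) then fin 0 else
  if memᵇ ν (i , j) then fin (π (i , j)) else ∞

IsRPP : List ℕ → Filling → Set
IsRPP ν π = ∀ u → u ∈ᵈ ν → (val ν π u ≤∞ val ν π (e u)) × (val ν π u ≤∞ val ν π (s u))

IsRPPx : List ℕ → Cell → Filling → Set
IsRPPx lam x π = IsRPP lam π × val lam π x ≡ max∞ (val lam π (n x)) (val lam π (w x))

ζ : List ℕ → Cell → Filling → Filling
ζ lam x π u with c u ℤ.≟ c x
... | yes _ =
  (unfin (max∞ (val lam π (n u)) (val lam π (w u)))
     ℕ.+ unfin (min∞ (val lam π (e u)) (val lam π (s u)))) ℕ.∸ π u
... | no _ = π u

cand : List ℕ → Filling → Cell → Set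
cand ν π u =
    (InO ν u × val ν π (w u) <∞ val ν π u)
  ⊎ (InA ν u × val ν π (w u) <∞ val ν π u × val ν π (n u) <∞ val ν π u)

_⊴_ : Cell → Cell → Set
(i , j) ⊴ (k , l) = (l - k ℤ.< j - i) ⊎ ((j - i ≡ l - k) × k ℤ.≤ i)

IsMinCand : List ℕ → Filling → Cell → Set
IsMinCand ν π v = cand ν π v × (∀ u → cand ν π u → v ⊴ u)

-- The sets 𝒪_ν and 𝒜_ν depend
-- only on contents, which can be read off row by row: row r contributes the outer content
-- ν_r − r when ν_{r+1} < ν_r, and the 𝒜-contents are those of the cells (r, j) with
-- ν_{r+1} < j < ν_r. Removing x changes these sets only on the diagonals c(x) − 1, c(x),
-- c(x) + 1, which gives (i) and the forward half of (iv). The remaining claims use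
-- minimality: a wrong answer would force an ascent π(w u) < π(u) at some u with 𝒪- or
-- 𝒜-content on a diagonal of larger content, and walking north from u while π(n u) = π(u)
-- keeps both properties until a candidate is reached, which precedes the minimal one.

module Submission where

open import Defs
open import Data.Bool using (Bool; true; false; _∧_; not; if_then_else_; T)
import Data.Bool.Properties as BP
open import Data.Empty using (⊥; ⊥-elim)
open import Data.Integer as ℤ using (ℤ; +_; -[1+_]; _-_; _+_; 1ℤ; -_)
import Data.Integer.Properties as ZP
open import Data.Integer.Tactic.RingSolver using (solve-∀)
open import Data.List using (List; []; _∷_; _++_; map; upTo; filterᵇ; length; applyUpTo)
import Data.List.Properties as LP
open import Data.List.Relation.Binary.Permutation.Propositional using (_↭_; ↭-refl; ↭-trans; ↭⇒↭ₛ)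
import Data.List.Relation.Binary.Permutation.Propositional.Properties as PP
open import Data.List.Relation.Binary.Pointwise using (Pointwise-≡⇒≡)
open import Data.List.Relation.Unary.All using (All; []; _∷_)
import Data.List.Relation.Unary.All as All
import Data.List.Relation.Unary.All.Properties as AllP
open import Data.List.Relation.Unary.AllPairs using (AllPairs; []; _∷_)
import Data.List.Relation.Unary.AllPairs.Properties as APP
open import Data.List.Relation.Unary.Linked using ([]; [-]; _∷_)
import Data.List.Relation.Unary.Linked.Properties as LkP
open import Data.List.Relation.Unary.Sorted.TotalOrder.Properties using (↗↭↗⇒≋)
open import Data.List.Sort.InsertionSort.Base ZP.≤-decTotalOrder using (sort)
open import Data.List.Sort.InsertionSort.Properties ZP.≤-decTotalOrder using (sort-↭; sort-↗)
open import Data.Maybe using (just; nothing)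
import Data.Maybe.Properties as MP
open import Data.Nat as ℕ using (ℕ; zero; suc; z≤n; s≤s; _<ᵇ_; _≡ᵇ_; _⊔_; _⊓_; _∸_)
import Data.Nat.Properties as NP
open import Data.Product using (Σ; ∃-syntax; _×_; _,_; proj₁; proj₂)
open import Data.Sum using (_⊎_; inj₁; inj₂; map₂)
open import Function.Bundles using (_⇔_; mk⇔; Equivalence)
open import Relation.Binary.Bundles using (DecTotalOrder)
open import Relation.Binary.Definitions using (tri<; tri≈; tri>)
open import Relation.Binary.PropositionalEquality
open import Relation.Nullary

private
  x-y+[y+z]≡x+z : ∀ (x y z : ℤ) → (x - y) + (y + z) ≡ x + z
  x-y+[y+z]≡x+z = solve-∀
  x-z+[y+z]≡x+y : ∀ (x y z : ℤ) → (x - z) + (y + z) ≡ x + y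
  x-z+[y+z]≡x+y = solve-∀
  x+k-k≡x : ∀ (x k : ℤ) → (x + k) - k ≡ x
  x+k-k≡x = solve-∀

+-cancelʳ-< : ∀ {x y} k → x + k ℤ.< y + k → x ℤ.< y
+-cancelʳ-< {x} {y} k h = subst₂ ℤ._<_ (x+k-k≡x x k) (x+k-k≡x y k) (ZP.+-monoˡ-< (- k) h)
+-cancelʳ-≤ : ∀ {x y} k → x + k ℤ.≤ y + k → x ℤ.≤ y
+-cancelʳ-≤ {x} {y} k h = subst₂ ℤ._≤_ (x+k-k≡x x k) (x+k-k≡x y k) (ZP.+-monoˡ-≤ (- k) h)
+-cancelʳ-≡ : ∀ {x y} k → x + k ≡ y + k → x ≡ y
+-cancelʳ-≡ {x} {y} k h = trans (sym (x+k-k≡x x k)) (trans (cong (_- k) h) (x+k-k≡x y k))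

sub<⇒cross< : ∀ a b c e → + a - + b ℤ.< + c - + e → a ℕ.+ e ℕ.< c ℕ.+ b
sub<⇒cross< a b c e h = ZP.drop‿+<+ (subst₂ ℤ._<_ (x-y+[y+z]≡x+z (+ a) (+ b) (+ e)) (x-z+[y+z]≡x+y (+ c) (+ b) (+ e)) (ZP.+-monoˡ-< (+ (b ℕ.+ e)) h))
cross<⇒sub< : ∀ a b c e → a ℕ.+ e ℕ.< c ℕ.+ b → + a - + b ℤ.< + c - + e
cross<⇒sub< a b c e h = +-cancelʳ-< (+ (b ℕ.+ e)) (subst₂ ℤ._<_ (sym (x-y+[y+z]≡x+z (+ a) (+ b) (+ e))) (sym (x-z+[y+z]≡x+y (+ c) (+ b) (+ e))) (ℤ.+<+ h))
sub≤⇒cross≤ : ∀ a b c e → + a - + b ℤ.≤ + c - + e → a ℕ.+ e ℕ.≤ c ℕ.+ b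
sub≤⇒cross≤ a b c e h = ZP.drop‿+≤+ (subst₂ ℤ._≤_ (x-y+[y+z]≡x+z (+ a) (+ b) (+ e)) (x-z+[y+z]≡x+y (+ c) (+ b) (+ e)) (ZP.+-monoˡ-≤ (+ (b ℕ.+ e)) h))
cross≤⇒sub≤ : ∀ a b c e → a ℕ.+ e ℕ.≤ c ℕ.+ b → + a - + b ℤ.≤ + c - + e
cross≤⇒sub≤ a b c e h = +-cancelʳ-≤ (+ (b ℕ.+ e)) (subst₂ ℤ._≤_ (sym (x-y+[y+z]≡x+z (+ a) (+ b) (+ e))) (sym (x-z+[y+z]≡x+y (+ c) (+ b) (+ e))) (ℤ.+≤+ h))
sub≡⇒cross≡ : ∀ a b c e → + a - + b ≡ + c - + e → a ℕ.+ e ≡ c ℕ.+ b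
sub≡⇒cross≡ a b c e h = ZP.+-injective (trans (sym (x-y+[y+z]≡x+z (+ a) (+ b) (+ e))) (trans (cong (_+ (+ (b ℕ.+ e))) h) (x-z+[y+z]≡x+y (+ c) (+ b) (+ e))))
cross≡⇒sub≡ : ∀ a b c e → a ℕ.+ e ≡ c ℕ.+ b → + a - + b ≡ + c - + e
cross≡⇒sub≡ a b c e h = +-cancelʳ-≡ (+ (b ℕ.+ e)) (trans (x-y+[y+z]≡x+z (+ a) (+ b) (+ e)) (trans (cong +_ h) (sym (x-z+[y+z]≡x+y (+ c) (+ b) (+ e)))))

sub-1≡sub-suc : ∀ a b → (+ a - + b) - 1ℤ ≡ + a - + suc b
sub-1≡sub-suc a b = trans (regroup (+ a) (+ b)) (cong (λ z → + a - z) (cong +_ (NP.+-comm b 1)))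
  where
  regroup : ∀ (A B : ℤ) → (A - B) - 1ℤ ≡ A - (B + 1ℤ)
  regroup = solve-∀
sub+1≡suc-sub : ∀ a b → (+ a - + b) + 1ℤ ≡ + suc a - + b
sub+1≡suc-sub a b = trans (regroup (+ a) (+ b)) (cong (λ z → z - + b) (cong +_ (NP.+-comm a 1)))
  where
  regroup : ∀ (A B : ℤ) → (A - B) + 1ℤ ≡ (A + 1ℤ) - B
  regroup = solve-∀

<ᵇ-true : ∀ {m n} → m ℕ.< n → (m <ᵇ n) ≡ true
<ᵇ-true {zero} {suc n} _ = refl
<ᵇ-true {suc m} {suc n} (s≤s p) = <ᵇ-true p

<ᵇ-false : ∀ {m n} → n ℕ.≤ m → (m <ᵇ n) ≡ false
<ᵇ-false {m} {zero} _ = refl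
<ᵇ-false {suc m} {suc n} (s≤s p) = <ᵇ-false p

≡ᵇ-refl : ∀ m → (m ≡ᵇ m) ≡ true
≡ᵇ-refl zero = refl
≡ᵇ-refl (suc m) = ≡ᵇ-refl m

≡ᵇ-false : ∀ {m n} → m ≢ n → (m ≡ᵇ n) ≡ false
≡ᵇ-false {zero} {zero} ne = ⊥-elim (ne refl)
≡ᵇ-false {zero} {suc n} ne = refl
≡ᵇ-false {suc m} {zero} ne = refl
≡ᵇ-false {suc m} {suc n} ne = ≡ᵇ-false (λ eq → ne (cong suc eq))

cell₊ : ℕ → ℕ → Cell
cell₊ i j = (+ suc i , + suc j)

e-cell₊ : ∀ i j → e (cell₊ i j) ≡ cell₊ i (suc j)
e-cell₊ i j = cong (λ z → (+ suc i , + suc z)) (NP.+-comm j 1)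

s-cell₊ : ∀ i j → s (cell₊ i j) ≡ cell₊ (suc i) j
s-cell₊ i j = cong (λ z → (+ suc z , + suc j)) (NP.+-comm i 1)

es-cell₊ : ∀ i j → e (s (cell₊ i j)) ≡ cell₊ (suc i) (suc j)
es-cell₊ i j = cong₂ (λ z y → (+ suc z , + suc y)) (NP.+-comm i 1) (NP.+-comm j 1)

isOuterᵇ-cell₊ : ∀ ν i j → isOuterᵇ ν (cell₊ i j) ≡
  (j <ᵇ rowLenℕ ν i) ∧ (not (suc j <ᵇ rowLenℕ ν i) ∧ not (j <ᵇ rowLenℕ ν (suc i)))
isOuterᵇ-cell₊ ν i j = cong₂ (λ a b → (j <ᵇ rowLenℕ ν i) ∧ (not a ∧ not b))
  (cong (memᵇ ν) (e-cell₊ i j)) (cong (memᵇ ν) (s-cell₊ i j))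

isInnerᵇ-cell₊ : ∀ ν i j → isInnerᵇ ν (cell₊ i j) ≡
  (suc j <ᵇ rowLenℕ ν i) ∧ ((j <ᵇ rowLenℕ ν (suc i)) ∧ not (suc j <ᵇ rowLenℕ ν (suc i)))
isInnerᵇ-cell₊ ν i j = cong₃ (cong (memᵇ ν) (e-cell₊ i j)) (cong (memᵇ ν) (s-cell₊ i j)) (cong (memᵇ ν) (es-cell₊ i j))
  where
  cong₃ : ∀ {a b c a' b' c' : Bool} → a ≡ a' → b ≡ b' → c ≡ c' → a ∧ (b ∧ not c) ≡ a' ∧ (b' ∧ not c')
  cong₃ refl refl refl = refl

filterᵇ-applyUpTo-none : {A : Set} (p : A → Bool) (g : ℕ → A) (m : ℕ) →
  (∀ j → j ℕ.< m → p (g j) ≡ false) → filterᵇ p (applyUpTo g m) ≡ []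
filterᵇ-applyUpTo-none p g zero h = refl
filterᵇ-applyUpTo-none p g (suc m) h rewrite h 0 (s≤s z≤n) = filterᵇ-applyUpTo-none p (λ j → g (suc j)) m (λ j lt → h (suc j) (s≤s lt))

filterᵇ-applyUpTo-single : {A : Set} (p : A → Bool) (g : ℕ → A) (m j0 : ℕ) → j0 ℕ.< m →
  (∀ j → j ℕ.< m → p (g j) ≡ (j ≡ᵇ j0)) → filterᵇ p (applyUpTo g m) ≡ g j0 ∷ []
filterᵇ-applyUpTo-single p g (suc m) zero lt h rewrite h 0 (s≤s z≤n) =
  cong (g 0 ∷_) (filterᵇ-applyUpTo-none p (λ j → g (suc j)) m (λ j lt → h (suc j) (s≤s lt)))
filterᵇ-applyUpTo-single p g (suc m) (suc j0) (s≤s lt) h rewrite h 0 (s≤s z≤n) =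
  filterᵇ-applyUpTo-single p (λ j → g (suc j)) m j0 lt (λ j lt' → h (suc j) (s≤s lt'))

-- The lengths of rows i and i + 1 are r and h.
rowOuterContent : ℕ → ℕ → ℕ → List ℤ
rowOuterContent i r h = if h <ᵇ r then (+ r - + suc i) ∷ [] else []

rowInnerContent : ℕ → ℕ → ℕ → List ℤ
rowInnerContent i r h = if (h <ᵇ r) ∧ (0 <ᵇ h) then (+ h - + suc i) ∷ [] else []

head₀ : List ℕ → ℕ
head₀ [] = 0
head₀ (r ∷ _) = r

outerContentsFrom innerContentsFrom : ℕ → List ℕ → List ℤ
outerContentsFrom i [] = []
outerContentsFrom i (r ∷ rs) = outerContentsFrom (suc i) rs ++ rowOuterContent i r (head₀ rs)
innerContentsFrom i [] = []
innerContentsFrom i (r ∷ rs) = innerContentsFrom (suc i) rs ++ rowInnerContent i r (head₀ rs)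

<ᵇ0-false : ∀ j → (j <ᵇ 0) ≡ false
<ᵇ0-false zero = refl
<ᵇ0-false (suc j) = refl

rowOuterContent-filter : ∀ ν i r h → rowLenℕ ν i ≡ r → rowLenℕ ν (suc i) ≡ h →
  map c (filterᵇ (isOuterᵇ ν) (map (λ j → (+ suc i , + suc j)) (upTo r))) ≡ rowOuterContent i r h
rowOuterContent-filter ν i r h eqR eqH = trans (cong (λ xs → map c (filterᵇ (isOuterᵇ ν) xs)) (LP.map-upTo (λ j → (+ suc i , + suc j)) r)) (go r h eqR eqH)
  where
  P : ∀ {r h} → rowLenℕ ν i ≡ r → rowLenℕ ν (suc i) ≡ h → ∀ j →
      isOuterᵇ ν (cell₊ i j) ≡ (j <ᵇ r) ∧ (not (suc j <ᵇ r) ∧ not (j <ᵇ h))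
  P refl refl j = isOuterᵇ-cell₊ ν i j
  Q1 : ∀ r' h → h ℕ.< suc r' → ∀ j → j ℕ.< suc r' → ((j <ᵇ suc r') ∧ (not (suc j <ᵇ suc r') ∧ not (j <ᵇ h))) ≡ (j ≡ᵇ r')
  Q1 r' h hl j jl with NP.m≤n⇒m<n∨m≡n (NP.≤-pred jl)
  ... | inj₁ j<r rewrite <ᵇ-true jl | <ᵇ-true j<r | ≡ᵇ-false {j} {r'} (NP.<⇒≢ j<r) = refl
  ... | inj₂ refl rewrite <ᵇ-true jl | <ᵇ-false {j} {j} NP.≤-refl | <ᵇ-false (NP.≤-pred hl) | ≡ᵇ-refl j = refl
  Q2 : ∀ r' h → ¬ h ℕ.< suc r' → ∀ j → j ℕ.< suc r' → ((j <ᵇ suc r') ∧ (not (suc j <ᵇ suc r') ∧ not (j <ᵇ h))) ≡ false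
  Q2 r' h hn j jl with NP.m≤n⇒m<n∨m≡n (NP.≤-pred jl)
  ... | inj₁ j<r rewrite <ᵇ-true jl | <ᵇ-true j<r = refl
  ... | inj₂ refl rewrite <ᵇ-true jl | <ᵇ-false {j} {j} NP.≤-refl | <ᵇ-true {j} {h} (NP.<-≤-trans NP.≤-refl (NP.≮⇒≥ hn)) = refl
  go : ∀ r h → rowLenℕ ν i ≡ r → rowLenℕ ν (suc i) ≡ h →
    map c (filterᵇ (isOuterᵇ ν) (applyUpTo (λ j → (+ suc i , + suc j)) r)) ≡ rowOuterContent i r h
  go zero h eqR eqH rewrite <ᵇ0-false h = refl
  go (suc r') h eqR eqH with h ℕ.<? suc r'
  ... | yes hl rewrite <ᵇ-true hl | filterᵇ-applyUpTo-single (isOuterᵇ ν) (cell₊ i) (suc r') r' NP.≤-refl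
          (λ j jl → trans (P eqR eqH j) (Q1 r' h hl j jl)) = refl
  ... | no hn rewrite <ᵇ-false (NP.≮⇒≥ hn) | filterᵇ-applyUpTo-none (isOuterᵇ ν) (cell₊ i) (suc r')
          (λ j jl → trans (P eqR eqH j) (Q2 r' h hn j jl)) = refl

rowInnerContent-filter : ∀ ν i r h → rowLenℕ ν i ≡ r → rowLenℕ ν (suc i) ≡ h →
  map c (filterᵇ (isInnerᵇ ν) (map (λ j → (+ suc i , + suc j)) (upTo r))) ≡ rowInnerContent i r h
rowInnerContent-filter ν i r h eqR eqH = trans (cong (λ xs → map c (filterᵇ (isInnerᵇ ν) xs)) (LP.map-upTo (λ j → (+ suc i , + suc j)) r)) (go r h eqR eqH)
  where
  P : ∀ {r h} → rowLenℕ ν i ≡ r → rowLenℕ ν (suc i) ≡ h → ∀ j →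
      isInnerᵇ ν (cell₊ i j) ≡ (suc j <ᵇ r) ∧ ((j <ᵇ h) ∧ not (suc j <ᵇ h))
  P refl refl j = isInnerᵇ-cell₊ ν i j
  Q1 : ∀ r h' → suc h' ℕ.< r → ∀ j → j ℕ.< r → ((suc j <ᵇ r) ∧ ((j <ᵇ suc h') ∧ not (suc j <ᵇ suc h'))) ≡ (j ≡ᵇ h')
  Q1 r h' hl j jl with NP.<-cmp j h'
  ... | tri< a _ _ rewrite <ᵇ-true {j} {suc h'} (NP.<-trans a NP.≤-refl) | <ᵇ-true a | ≡ᵇ-false {j} {h'} (NP.<⇒≢ a) = BP.∧-zeroʳ _
  ... | tri≈ _ refl _ rewrite <ᵇ-true hl | <ᵇ-true {j} {suc j} NP.≤-refl | <ᵇ-false {j} {j} NP.≤-refl | ≡ᵇ-refl j = refl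
  ... | tri> _ _ a rewrite <ᵇ-false {j} {suc h'} a | ≡ᵇ-false {j} {h'} (NP.>⇒≢ a) = BP.∧-zeroʳ _
  Q2 : ∀ r h' → ¬ suc h' ℕ.< r → ∀ j → j ℕ.< r → ((suc j <ᵇ r) ∧ ((j <ᵇ suc h') ∧ not (suc j <ᵇ suc h'))) ≡ false
  Q2 r h' hn j jl with suc j ℕ.<? suc h'
  ... | yes a rewrite <ᵇ-true a | <ᵇ-true {j} {suc h'} (NP.<-trans NP.≤-refl a) = BP.∧-zeroʳ _
  ... | no a with suc j ℕ.<? r
  ...   | yes b = ⊥-elim (hn (NP.≤-trans (s≤s (NP.≮⇒≥ a)) b))
  ...   | no b rewrite <ᵇ-false (NP.≮⇒≥ b) = refl
  go : ∀ r h → rowLenℕ ν i ≡ r → rowLenℕ ν (suc i) ≡ h →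
    map c (filterᵇ (isInnerᵇ ν) (applyUpTo (λ j → (+ suc i , + suc j)) r)) ≡ rowInnerContent i r h
  go r zero eqR eqH rewrite BP.∧-zeroʳ (0 <ᵇ r) | filterᵇ-applyUpTo-none (isInnerᵇ ν) (cell₊ i) r
          (λ j jl → trans (P eqR eqH j) (trans (cong (λ z → (suc j <ᵇ r) ∧ (z ∧ not (suc j <ᵇ 0))) (<ᵇ0-false j)) (BP.∧-zeroʳ _))) = refl
  go r (suc h') eqR eqH with suc h' ℕ.<? r
  ... | yes hl rewrite <ᵇ-true hl | filterᵇ-applyUpTo-single (isInnerᵇ ν) (cell₊ i) r h' (NP.<-trans NP.≤-refl hl)
          (λ j jl → trans (P eqR eqH j) (Q1 r h' hl j jl)) = refl
  ... | no hn rewrite <ᵇ-false (NP.≮⇒≥ hn) | filterᵇ-applyUpTo-none (isInnerᵇ ν) (cell₊ i) r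
          (λ j jl → trans (P eqR eqH j) (Q2 r h' hn j jl)) = refl

rowLenℕ-zero≡head₀ : ∀ rs → rowLenℕ rs 0 ≡ head₀ rs
rowLenℕ-zero≡head₀ [] = refl
rowLenℕ-zero≡head₀ (r ∷ rs) = refl

RowsFrom : List ℕ → ℕ → List ℕ → Set
RowsFrom ν i rs = ∀ k → rowLenℕ ν (i ℕ.+ k) ≡ rowLenℕ rs k

RowsFrom-tail : ∀ {ν i r rs} → RowsFrom ν i (r ∷ rs) → RowsFrom ν (suc i) rs
RowsFrom-tail {ν} {i} H k = trans (cong (rowLenℕ ν) (sym (NP.+-suc i k))) (H (suc k))

RowsFrom-head : ∀ {ν i r rs} → RowsFrom ν i (r ∷ rs) → rowLenℕ ν i ≡ r
RowsFrom-head {ν} {i} H = trans (cong (rowLenℕ ν) (sym (NP.+-identityʳ i))) (H 0)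

RowsFrom-next : ∀ {ν i r rs} → RowsFrom ν i (r ∷ rs) → rowLenℕ ν (suc i) ≡ head₀ rs
RowsFrom-next {ν} {i} {r} {rs} H = trans (cong (rowLenℕ ν) (NP.+-comm 1 i)) (trans (H 1) (rowLenℕ-zero≡head₀ rs))

cellsFrom-outer-↭ : ∀ ν i rs → RowsFrom ν i rs → map c (filterᵇ (isOuterᵇ ν) (cellsFrom i rs)) ↭ outerContentsFrom i rs
cellsFrom-outer-↭ ν i [] H = ↭-refl
cellsFrom-outer-↭ ν i (r ∷ rs) H
  rewrite LP.filter-++ (λ u → Data.Bool.T? (isOuterᵇ ν u)) (map (λ j → (+ suc i , + suc j)) (upTo r)) (cellsFrom (suc i) rs)
        | LP.map-++ c (filterᵇ (isOuterᵇ ν) (map (λ j → (+ suc i , + suc j)) (upTo r))) (filterᵇ (isOuterᵇ ν) (cellsFrom (suc i) rs))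
        | rowOuterContent-filter ν i r (head₀ rs) (RowsFrom-head {ν} {i} {r} {rs} H) (RowsFrom-next {ν} {i} {r} {rs} H)
  = ↭-trans (PP.++-comm (rowOuterContent i r (head₀ rs)) _) (PP.++⁺ʳ (rowOuterContent i r (head₀ rs)) (cellsFrom-outer-↭ ν (suc i) rs (RowsFrom-tail {ν} {i} {r} {rs} H)))

cellsFrom-inner-↭ : ∀ ν i rs → RowsFrom ν i rs → map c (filterᵇ (isInnerᵇ ν) (cellsFrom i rs)) ↭ innerContentsFrom i rs
cellsFrom-inner-↭ ν i [] H = ↭-refl
cellsFrom-inner-↭ ν i (r ∷ rs) H
  rewrite LP.filter-++ (λ u → Data.Bool.T? (isInnerᵇ ν u)) (map (λ j → (+ suc i , + suc j)) (upTo r)) (cellsFrom (suc i) rs)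
        | LP.map-++ c (filterᵇ (isInnerᵇ ν) (map (λ j → (+ suc i , + suc j)) (upTo r))) (filterᵇ (isInnerᵇ ν) (cellsFrom (suc i) rs))
        | rowInnerContent-filter ν i r (head₀ rs) (RowsFrom-head {ν} {i} {r} {rs} H) (RowsFrom-next {ν} {i} {r} {rs} H)
  = ↭-trans (PP.++-comm (rowInnerContent i r (head₀ rs)) _) (PP.++⁺ʳ (rowInnerContent i r (head₀ rs)) (cellsFrom-inner-↭ ν (suc i) rs (RowsFrom-tail {ν} {i} {r} {rs} H)))

IsPartition-tail : ∀ {r rs} → IsPartition (r ∷ rs) → IsPartition rs
IsPartition-tail [-] = []
IsPartition-tail (_ ∷ p) = p

IsPartition-head : ∀ {r rs} → IsPartition (r ∷ rs) → head₀ rs ℕ.≤ r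
IsPartition-head {rs = []} _ = z≤n
IsPartition-head {rs = _ ∷ _} (x ∷ _) = x

outerContentsFrom-bound : ∀ i rs → IsPartition rs → All (λ z → z ℤ.< + head₀ rs - + i) (outerContentsFrom i rs)
outerContentsFrom-bound i [] p = []
outerContentsFrom-bound i (r ∷ rs) p = AllP.++⁺ (All.map (λ {z} lt → ZP.<-trans lt (cross<⇒sub< (head₀ rs) (suc i) r i (NP.+-mono-≤-< (IsPartition-head p) NP.≤-refl))) (outerContentsFrom-bound (suc i) rs (IsPartition-tail p))) ext
  where
  ext : All (λ z → z ℤ.< + r - + i) (rowOuterContent i r (head₀ rs))
  ext with head₀ rs ℕ.<? r
  ... | yes l rewrite <ᵇ-true l = cross<⇒sub< r (suc i) r i (NP.+-monoʳ-< r NP.≤-refl) ∷ []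
  ... | no l rewrite <ᵇ-false (NP.≮⇒≥ l) = []

innerContentsFrom-bound : ∀ i rs → IsPartition rs → All (λ z → z ℤ.< + head₀ rs - + i) (innerContentsFrom i rs)
innerContentsFrom-bound i [] p = []
innerContentsFrom-bound i (r ∷ rs) p = AllP.++⁺ (All.map (λ {z} lt → ZP.<-trans lt newlt) (innerContentsFrom-bound (suc i) rs (IsPartition-tail p))) ext
  where
  newlt : + head₀ rs - + suc i ℤ.< + r - + i
  newlt = cross<⇒sub< (head₀ rs) (suc i) r i (NP.+-mono-≤-< (IsPartition-head p) NP.≤-refl)
  ext : All (λ z → z ℤ.< + r - + i) (rowInnerContent i r (head₀ rs))
  ext with (head₀ rs <ᵇ r) ∧ (0 <ᵇ head₀ rs)
  ... | true = newlt ∷ []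
  ... | false = []

outerContentsFrom-sorted : ∀ i rs → IsPartition rs → AllPairs ℤ._≤_ (outerContentsFrom i rs)
outerContentsFrom-sorted i [] p = []
outerContentsFrom-sorted i (r ∷ rs) p = APP.++⁺ (outerContentsFrom-sorted (suc i) rs (IsPartition-tail p)) ext (All.map (λ {z} lt → cross lt) (outerContentsFrom-bound (suc i) rs (IsPartition-tail p)))
  where
  ext : AllPairs ℤ._≤_ (rowOuterContent i r (head₀ rs))
  ext with head₀ rs <ᵇ r
  ... | true = [] ∷ []
  ... | false = []
  cross : ∀ {z} → z ℤ.< + head₀ rs - + suc i → All (z ℤ.≤_) (rowOuterContent i r (head₀ rs))
  cross lt with head₀ rs <ᵇ r
  ... | true = ZP.<⇒≤ (ZP.<-≤-trans lt (cross≤⇒sub≤ (head₀ rs) (suc i) r (suc i) (NP.+-monoˡ-≤ (suc i) (IsPartition-head p)))) ∷ []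
  ... | false = []

innerContentsFrom-sorted : ∀ i rs → IsPartition rs → AllPairs ℤ._≤_ (innerContentsFrom i rs)
innerContentsFrom-sorted i [] p = []
innerContentsFrom-sorted i (r ∷ rs) p = APP.++⁺ (innerContentsFrom-sorted (suc i) rs (IsPartition-tail p)) ext (All.map (λ {z} lt → cross lt) (innerContentsFrom-bound (suc i) rs (IsPartition-tail p)))
  where
  ext : AllPairs ℤ._≤_ (rowInnerContent i r (head₀ rs))
  ext with (head₀ rs <ᵇ r) ∧ (0 <ᵇ head₀ rs)
  ... | true = [] ∷ []
  ... | false = []
  cross : ∀ {z} → z ℤ.< + head₀ rs - + suc i → All (z ℤ.≤_) (rowInnerContent i r (head₀ rs))
  cross lt with (head₀ rs <ᵇ r) ∧ (0 <ᵇ head₀ rs)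
  ... | true = ZP.<⇒≤ lt ∷ []
  ... | false = []

sort-unique : ∀ xs ys → AllPairs ℤ._≤_ ys → xs ↭ ys → sort xs ≡ ys
sort-unique xs ys sy p = Pointwise-≡⇒≡ (↗↭↗⇒≋ (DecTotalOrder.totalOrder ZP.≤-decTotalOrder) (sort-↗ xs) (LkP.AllPairs⇒Linked sy) (↭⇒↭ₛ (↭-trans (sort-↭ xs) p)))

RowsFrom-zero : ∀ ν → RowsFrom ν 0 ν
RowsFrom-zero ν k = refl

outerContents≡ : ∀ ν → IsPartition ν → outerContents ν ≡ outerContentsFrom 0 ν
outerContents≡ ν p = sort-unique _ _ (outerContentsFrom-sorted 0 ν p) (cellsFrom-outer-↭ ν 0 ν (RowsFrom-zero ν))

innerContents≡ : ∀ ν → IsPartition ν → innerContents ν ≡ innerContentsFrom 0 ν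
innerContents≡ ν p = sort-unique _ _ (innerContentsFrom-sorted 0 ν p) (cellsFrom-inner-↭ ν 0 ν (RowsFrom-zero ν))

nth-len : ∀ xs k {z} → nth xs k ≡ just z → k ℕ.< length xs
nth-len (x ∷ xs) zero eq = s≤s z≤n
nth-len (x ∷ xs) (suc k) eq = s≤s (nth-len xs k eq)

nth-++ˡ : ∀ xs ys k → k ℕ.< length xs → nth (xs ++ ys) k ≡ nth xs k
nth-++ˡ (x ∷ xs) ys zero lt = refl
nth-++ˡ (x ∷ xs) ys (suc k) (s≤s lt) = nth-++ˡ xs ys k lt

nth-last : ∀ xs (y : ℤ) → nth (xs ++ y ∷ []) (length xs) ≡ just y
nth-last [] y = refl
nth-last (x ∷ xs) y = nth-last xs y

nth-snoc-inv : ∀ xs (y : ℤ) k {z} → nth (xs ++ y ∷ []) k ≡ just z → (nth xs k ≡ just z) ⊎ (k ≡ length xs × z ≡ y)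
nth-snoc-inv [] y zero refl = inj₂ (refl , refl)
nth-snoc-inv [] y (suc k) ()
nth-snoc-inv (x ∷ xs) y zero eq = inj₁ eq
nth-snoc-inv (x ∷ xs) y (suc k) eq with nth-snoc-inv xs y k eq
... | inj₁ p = inj₁ p
... | inj₂ (p , q) = inj₂ (cong suc p , q)

nth-++-inv : ∀ xs ys k {z} → nth (xs ++ ys) k ≡ just z → (nth xs k ≡ just z) ⊎ (Σ ℕ λ k' → nth ys k' ≡ just z)
nth-++-inv [] ys k eq = inj₂ (k , eq)
nth-++-inv (x ∷ xs) ys zero eq = inj₁ eq
nth-++-inv (x ∷ xs) ys (suc k) eq = nth-++-inv xs ys k eq

nth-++ʳ : ∀ xs ys k {z} → nth ys k ≡ just z → nth (xs ++ ys) (length xs ℕ.+ k) ≡ just z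
nth-++ʳ [] ys k eq = eq
nth-++ʳ (x ∷ xs) ys k eq = nth-++ʳ xs ys k eq

-- Rows are counted from 0, so row k of ν is row k + 1 of the Young diagram.
IsOuterContent : List ℕ → ℤ → Set
IsOuterContent ν d = Σ ℕ λ k → (rowLenℕ ν (suc k) ℕ.< rowLenℕ ν k) × (d ≡ + rowLenℕ ν k - + suc k)

IsAContent : List ℕ → ℤ → Set
IsAContent ν d = Σ ℕ λ k → Σ ℕ λ j → (rowLenℕ ν (suc k) ℕ.< j) × (j ℕ.< rowLenℕ ν k) × (d ≡ + j - + suc k)

IsCandContent : List ℕ → ℤ → Set
IsCandContent ν d = IsOuterContent ν d ⊎ IsAContent ν d

IsOuterContentFrom : ℕ → List ℕ → ℤ → Set
IsOuterContentFrom i rs d = Σ ℕ λ k → (rowLenℕ rs (suc k) ℕ.< rowLenℕ rs k) × (d ≡ + rowLenℕ rs k - + suc (i ℕ.+ k))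

IsAContentFrom : ℕ → List ℕ → ℤ → Set
IsAContentFrom i rs d = Σ ℕ λ k → Σ ℕ λ j → (rowLenℕ rs (suc k) ℕ.< j) × (j ℕ.< rowLenℕ rs k) × (d ≡ + j - + suc (i ℕ.+ k))

rowOuterContent-inv : ∀ i r h k {z} → nth (rowOuterContent i r h) k ≡ just z → (h ℕ.< r) × (z ≡ + r - + suc i)
rowOuterContent-inv i r h k eq with h ℕ.<? r
rowOuterContent-inv i r h zero eq | yes l rewrite <ᵇ-true l = l , sym (MP.just-injective eq)
rowOuterContent-inv i r h (suc k) eq | yes l rewrite <ᵇ-true l = ⊥-elim (nj eq) where
  nj : nothing ≡ just _ → ⊥
  nj ()
rowOuterContent-inv i r h k eq | no l rewrite <ᵇ-false (NP.≮⇒≥ l) with k | eq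
... | zero | ()
... | suc _ | ()

outerContentsFrom-sound : ∀ i rs k d → nth (outerContentsFrom i rs) k ≡ just d → IsOuterContentFrom i rs d
outerContentsFrom-sound i [] k d ()
outerContentsFrom-sound i (r ∷ rs) k d eq with nth-++-inv (outerContentsFrom (suc i) rs) (rowOuterContent i r (head₀ rs)) k eq
... | inj₁ p with outerContentsFrom-sound (suc i) rs k d p
...   | (k' , a , b) = suc k' , a , trans b (cong (λ z → + rowLenℕ rs k' - + suc z) (sym (NP.+-suc i k')))
outerContentsFrom-sound i (r ∷ rs) k d eq | inj₂ (k' , p) with rowOuterContent-inv i r (head₀ rs) k' p
... | (l , q) = 0 , subst (ℕ._< r) (sym (rowLenℕ-zero≡head₀ rs)) l , trans q (cong (λ z → + r - + suc z) (sym (NP.+-identityʳ i)))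

outerContentsFrom-complete : ∀ i rs d → IsOuterContentFrom i rs d → Σ ℕ λ k → nth (outerContentsFrom i rs) k ≡ just d
outerContentsFrom-complete i [] d (k , () , _)
outerContentsFrom-complete i (r ∷ rs) d (zero , l , eq) = length (outerContentsFrom (suc i) rs) ℕ.+ 0 , nth-++ʳ (outerContentsFrom (suc i) rs) _ 0 ext
  where
  l' : head₀ rs ℕ.< r
  l' = subst (ℕ._< r) (rowLenℕ-zero≡head₀ rs) l
  ext : nth (rowOuterContent i r (head₀ rs)) 0 ≡ just d
  ext rewrite <ᵇ-true l' = cong just (sym (trans eq (cong (λ z → + r - + suc z) (NP.+-identityʳ i))))
outerContentsFrom-complete i (r ∷ rs) d (suc k , l , eq) with outerContentsFrom-complete (suc i) rs d (k , l , trans eq (cong (λ z → + rowLenℕ rs k - + suc z) (NP.+-suc i k)))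
... | (k' , p) = k' , trans (nth-++ˡ (outerContentsFrom (suc i) rs) _ k' (nth-len (outerContentsFrom (suc i) rs) k' p)) p

InAContents : List ℤ → List ℤ → ℤ → Set
InAContents S T d = (∃[ o₁ ] (nth S 0 ≡ just o₁ × d ℤ.< o₁))
  ⊎ (∃[ k ] ∃[ a ] ∃[ b ] (nth T k ≡ just a × nth S (suc k) ≡ just b × a ℤ.< d × d ℤ.< b))

ContentLowerBound : ℕ → List ℕ → ℤ → Set
ContentLowerBound i rs d = Σ ℕ λ k → (0 ℕ.< rowLenℕ rs k) × (+ 1 - + suc (i ℕ.+ k) ℤ.≤ d)

emptyHead⇒rowLenℕ≡0 : ∀ rs → IsPartition rs → head₀ rs ≡ 0 → ∀ k → rowLenℕ rs k ≡ 0
emptyHead⇒rowLenℕ≡0 [] p h k = refl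
emptyHead⇒rowLenℕ≡0 (r ∷ rs) p refl zero = refl
emptyHead⇒rowLenℕ≡0 (r ∷ rs) p refl (suc k) = emptyHead⇒rowLenℕ≡0 rs (IsPartition-tail p) (NP.n≤0⇒n≡0 (IsPartition-head p)) k

emptyHead⇒contents≡[] : ∀ i rs → IsPartition rs → head₀ rs ≡ 0 → (outerContentsFrom i rs ≡ []) × (innerContentsFrom i rs ≡ [])
emptyHead⇒contents≡[] i [] p h = refl , refl
emptyHead⇒contents≡[] i (r ∷ rs) p refl with NP.n≤0⇒n≡0 (IsPartition-head p)
... | h0 with emptyHead⇒contents≡[] (suc i) rs (IsPartition-tail p) h0
... | (e1 , e2) rewrite e1 | e2 = refl , refl

rowContents-length : ∀ i r h → 0 ℕ.< h → length (rowOuterContent i r h) ≡ length (rowInnerContent i r h)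
rowContents-length i r (suc h) _ rewrite BP.∧-identityʳ (suc h <ᵇ r) with suc h <ᵇ r
... | true = refl
... | false = refl

outer-inner-length : ∀ i rs → IsPartition rs → 0 ℕ.< head₀ rs → length (outerContentsFrom i rs) ≡ suc (length (innerContentsFrom i rs))
outer-inner-length i (r ∷ rs) p pos with head₀ rs ℕ.≟ 0
... | yes h0 with emptyHead⇒contents≡[] (suc i) rs (IsPartition-tail p) h0
...   | (e1 , e2) rewrite e1 | e2 | h0 | <ᵇ-true pos = refl
outer-inner-length i (r ∷ rs) p pos | no hn
  rewrite LP.length-++ (outerContentsFrom (suc i) rs) {rowOuterContent i r (head₀ rs)} | LP.length-++ (innerContentsFrom (suc i) rs) {rowInnerContent i r (head₀ rs)}
        | outer-inner-length (suc i) rs (IsPartition-tail p) (NP.n≢0⇒n>0 hn) | rowContents-length i r (head₀ rs) (NP.n≢0⇒n>0 hn) = refl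

InAContents-snoc⁻ : ∀ S' T' o t d → length S' ≡ suc (length T') → InAContents (S' ++ o ∷ []) (T' ++ t ∷ []) d → InAContents S' T' d ⊎ (t ℤ.< d × d ℤ.< o)
InAContents-snoc⁻ [] T' o t d () _
InAContents-snoc⁻ (s ∷ S') T' o t d eqL (inj₁ (o₁ , eq , lt)) = inj₁ (inj₁ (o₁ , eq , lt))
InAContents-snoc⁻ S'@(_ ∷ _) T' o t d eqL (inj₂ (k , a , b , ea , eb , l1 , l2)) with nth-snoc-inv T' t k ea
... | inj₁ p = inj₁ (inj₂ (k , a , b , p , trans (sym (nth-++ˡ S' (o ∷ []) (suc k) (subst (suc (suc k) ℕ.≤_) (sym eqL) (s≤s (nth-len T' k p))))) eb , l1 , l2))
... | inj₂ (refl , refl) = inj₂ (l1 , subst (d ℤ.<_) (MP.just-injective (trans (sym eb) (subst (λ z → nth (S' ++ o ∷ []) z ≡ just o) eqL (nth-last S' o)))) l2)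

InAContents-snoc⁺ : ∀ S' T' o t d → length S' ≡ suc (length T') → InAContents S' T' d ⊎ (t ℤ.< d × d ℤ.< o) → InAContents (S' ++ o ∷ []) (T' ++ t ∷ []) d
InAContents-snoc⁺ [] T' o t d () _
InAContents-snoc⁺ (s ∷ S') T' o t d eqL (inj₁ (inj₁ (o₁ , eq , lt))) = inj₁ (o₁ , eq , lt)
InAContents-snoc⁺ S'@(_ ∷ _) T' o t d eqL (inj₁ (inj₂ (k , a , b , ea , eb , l1 , l2))) =
  inj₂ (k , a , b , trans (nth-++ˡ T' (t ∷ []) k (nth-len T' k ea)) ea , trans (nth-++ˡ S' (o ∷ []) (suc k) (nth-len S' (suc k) eb)) eb , l1 , l2)
InAContents-snoc⁺ S'@(_ ∷ _) T' o t d eqL (inj₂ (l1 , l2)) =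
  inj₂ (length T' , t , o , nth-last T' t , subst (λ z → nth (S' ++ o ∷ []) z ≡ just o) eqL (nth-last S' o) , l1 , l2)

InAContents-single : ∀ o d → InAContents (o ∷ []) [] d → d ℤ.< o
InAContents-single o d (inj₁ (o₁ , refl , lt)) = lt
InAContents-single o d (inj₂ (k , a , b , () , _))

content-between⇒column : ∀ i r h m n → (+ h - + suc i ℤ.< + m - + n) → (+ m - + n ℤ.< + r - + suc i) →
  Σ ℕ λ j → (h ℕ.< j) × (j ℕ.< r) × (+ m - + n ≡ + j - + suc (i ℕ.+ 0))
content-between⇒column i r h m n l1 l2 = j , NP.+-cancelʳ-< n h j a1 , NP.+-cancelʳ-< n j r a2 ,
    cross≡⇒sub≡ m n j (suc (i ℕ.+ 0)) (trans (cong (λ z → m ℕ.+ suc z) (NP.+-identityʳ i)) (sym jn))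
  where
  A : h ℕ.+ n ℕ.< m ℕ.+ suc i
  A = sub<⇒cross< h (suc i) m n l1
  B : m ℕ.+ suc i ℕ.< r ℕ.+ n
  B = sub<⇒cross< m n r (suc i) l2
  j = (m ℕ.+ suc i) ℕ.∸ n
  jn : j ℕ.+ n ≡ m ℕ.+ suc i
  jn = NP.m∸n+n≡m (NP.≤-trans (NP.m≤n+m n h) (NP.<⇒≤ A))
  a1 : h ℕ.+ n ℕ.< j ℕ.+ n
  a1 = subst (h ℕ.+ n ℕ.<_) (sym jn) A
  a2 : j ℕ.+ n ℕ.< r ℕ.+ n
  a2 = subst (ℕ._< r ℕ.+ n) (sym jn) B

column⇒content-between : ∀ i r h j d → h ℕ.< j → j ℕ.< r → d ≡ + j - + suc (i ℕ.+ 0) → (+ h - + suc i ℤ.< d) × (d ℤ.< + r - + suc i)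
column⇒content-between i r h j d l1 l2 refl rewrite NP.+-identityʳ i =
  cross<⇒sub< h (suc i) j (suc i) (NP.+-monoˡ-< (suc i) l1) , cross<⇒sub< j (suc i) r (suc i) (NP.+-monoˡ-< (suc i) l2)

ContentLowerBound-tail : ∀ i r rs d → 0 ℕ.< head₀ rs → ContentLowerBound i (r ∷ rs) d → ContentLowerBound (suc i) rs d
ContentLowerBound-tail i r rs d pos (zero , _ , le) = 0 , subst (0 ℕ.<_) (sym (rowLenℕ-zero≡head₀ rs)) pos ,
  ZP.≤-trans (cross≤⇒sub≤ 1 (suc (suc i ℕ.+ 0)) 1 (suc (i ℕ.+ 0)) (s≤s (NP.n≤1+n _))) le
ContentLowerBound-tail i r rs d pos (suc k , p , le) = k , p , subst (λ z → + 1 - + suc z ℤ.≤ d) (NP.+-suc i k) le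

IsAContentFrom-shift : ∀ i r rs d → IsAContentFrom (suc i) rs d → IsAContentFrom i (r ∷ rs) d
IsAContentFrom-shift i r rs d (k , j , a , b , eq) = suc k , j , a , b , trans eq (cong (λ z → + j - + suc z) (sym (NP.+-suc i k)))

IsAContentFrom⇒InAContents : ∀ i rs d → IsPartition rs → IsAContentFrom i rs d → InAContents (outerContentsFrom i rs) (innerContentsFrom i rs) d
IsAContentFrom⇒InAContents i [] d p (k , j , a , () , _)
IsAContentFrom⇒InAContents i (r ∷ rs) d p acl with head₀ rs ℕ.<? r
... | no nl rewrite <ᵇ-false (NP.≮⇒≥ nl) | LP.++-identityʳ (outerContentsFrom (suc i) rs) | LP.++-identityʳ (innerContentsFrom (suc i) rs) with acl
...   | (zero , j , a , b , eq) = ⊥-elim (nl (NP.<-trans (subst (ℕ._< j) (rowLenℕ-zero≡head₀ rs) a) b))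
...   | (suc k , j , a , b , eq) = IsAContentFrom⇒InAContents (suc i) rs d (IsPartition-tail p) (k , j , a , b , trans eq (cong (λ z → + j - + suc z) (NP.+-suc i k)))
IsAContentFrom⇒InAContents i (r ∷ rs) d p acl | yes l with head₀ rs ℕ.≟ 0
... | yes h0 with emptyHead⇒contents≡[] (suc i) rs (IsPartition-tail p) h0
...   | (e1 , e2) rewrite e1 | e2 | h0 | <ᵇ-true l = go acl
  where
  go : IsAContentFrom i (r ∷ rs) d → InAContents ((+ r - + suc i) ∷ []) [] d
  go (zero , j , a , b , eq) = inj₁ (_ , refl , proj₂ (column⇒content-between i r 0 j d (subst (ℕ._< j) (trans (rowLenℕ-zero≡head₀ rs) h0) a) b eq))
  go (suc k , j , a , b , eq) = ⊥-elim (NP.n≮0 (subst (j ℕ.<_) (emptyHead⇒rowLenℕ≡0 rs (IsPartition-tail p) h0 k) b))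
IsAContentFrom⇒InAContents i (r ∷ rs) d p acl | yes l | no hn rewrite <ᵇ-true l | <ᵇ-true (NP.n≢0⇒n>0 hn) =
  InAContents-snoc⁺ (outerContentsFrom (suc i) rs) (innerContentsFrom (suc i) rs) _ _ d (outer-inner-length (suc i) rs (IsPartition-tail p) (NP.n≢0⇒n>0 hn)) (sub acl)
  where
  sub : IsAContentFrom i (r ∷ rs) d → InAContents (outerContentsFrom (suc i) rs) (innerContentsFrom (suc i) rs) d ⊎ ((+ head₀ rs - + suc i ℤ.< d) × (d ℤ.< + r - + suc i))
  sub (zero , j , a , b , eq) = inj₂ (column⇒content-between i r (head₀ rs) j d (subst (ℕ._< j) (rowLenℕ-zero≡head₀ rs) a) b eq)
  sub (suc k , j , a , b , eq) = inj₁ (IsAContentFrom⇒InAContents (suc i) rs d (IsPartition-tail p) (k , j , a , b , trans eq (cong (λ z → + j - + suc z) (NP.+-suc i k))))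

InAContents⇒IsAContentFrom : ∀ i rs m n → IsPartition rs → ContentLowerBound i rs (+ m - + n) → InAContents (outerContentsFrom i rs) (innerContentsFrom i rs) (+ m - + n) → IsAContentFrom i rs (+ m - + n)
InAContents⇒IsAContentFrom i [] m n p (k , () , _) al
InAContents⇒IsAContentFrom i (r ∷ rs) m n p lb al with head₀ rs ℕ.<? r
... | no nl rewrite <ᵇ-false (NP.≮⇒≥ nl) | LP.++-identityʳ (outerContentsFrom (suc i) rs) | LP.++-identityʳ (innerContentsFrom (suc i) rs) with r
...   | zero = ⊥-elim (absurd lb)
  where
  absurd : ContentLowerBound i (0 ∷ rs) (+ m - + n) → ⊥
  absurd (zero , () , _)
  absurd (suc k , q , _) = NP.<-irrefl refl (subst (0 ℕ.<_) (emptyHead⇒rowLenℕ≡0 rs (IsPartition-tail p) (NP.n≤0⇒n≡0 (IsPartition-head p)) k) q)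
...   | suc r' = IsAContentFrom-shift i (suc r') rs _ (InAContents⇒IsAContentFrom (suc i) rs m n (IsPartition-tail p) (ContentLowerBound-tail i (suc r') rs _ pos lb) al)
  where
  pos : 0 ℕ.< head₀ rs
  pos = NP.<-≤-trans (s≤s z≤n) (NP.≮⇒≥ nl)
InAContents⇒IsAContentFrom i (r ∷ rs) m n p lb al | yes l with head₀ rs ℕ.≟ 0
... | yes h0 with emptyHead⇒contents≡[] (suc i) rs (IsPartition-tail p) h0
...   | (e1 , e2) rewrite e1 | e2 | h0 | <ᵇ-true l = go lb
  where
  dlt : + m - + n ℤ.< + r - + suc i
  dlt = InAContents-single _ _ al
  go : ContentLowerBound i (r ∷ rs) (+ m - + n) → IsAContentFrom i (r ∷ rs) (+ m - + n)
  go (zero , _ , le) with content-between⇒column i r 0 m n (cross<⇒sub< 0 (suc i) m n (subst (λ z → 1 ℕ.+ n ℕ.≤ m ℕ.+ suc z) (NP.+-identityʳ i) (sub≤⇒cross≤ 1 (suc (i ℕ.+ 0)) m n le))) dlt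
  ... | (j , a , b , eq) = 0 , j , subst (ℕ._< j) (sym (trans (rowLenℕ-zero≡head₀ rs) h0)) a , b , eq
  go (suc k , q , _) = ⊥-elim (NP.<-irrefl refl (subst (0 ℕ.<_) (emptyHead⇒rowLenℕ≡0 rs (IsPartition-tail p) h0 k) q))
InAContents⇒IsAContentFrom i (r ∷ rs) m n p lb al | yes l | no hn rewrite <ᵇ-true l | <ᵇ-true (NP.n≢0⇒n>0 hn)
  with InAContents-snoc⁻ (outerContentsFrom (suc i) rs) (innerContentsFrom (suc i) rs) _ _ _ (outer-inner-length (suc i) rs (IsPartition-tail p) (NP.n≢0⇒n>0 hn)) al
... | inj₁ al' = IsAContentFrom-shift i r rs _ (InAContents⇒IsAContentFrom (suc i) rs m n (IsPartition-tail p) (ContentLowerBound-tail i r rs _ (NP.n≢0⇒n>0 hn) lb) al')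
... | inj₂ (l1 , l2) with content-between⇒column i r (head₀ rs) m n l1 l2
...   | (j , a , b , eq) = 0 , j , subst (ℕ._< j) (sym (rowLenℕ-zero≡head₀ rs)) a , b , eq

∈ᵈ-view : ∀ ν u → u ∈ᵈ ν → Σ ℕ λ p → Σ ℕ λ q → (u ≡ cell₊ p q) × (q ℕ.< rowLenℕ ν p)
∈ᵈ-view ν (+ zero , j) ()
∈ᵈ-view ν (-[1+ _ ] , j) ()
∈ᵈ-view ν (+ suc p , + zero) ()
∈ᵈ-view ν (+ suc p , -[1+ _ ]) ()
∈ᵈ-view ν (+ suc p , + suc q) m = p , q , refl , NP.<ᵇ⇒< q (rowLenℕ ν p) m

InO⇒IsOuterContent : ∀ ν u → IsPartition ν → InO ν u → IsOuterContent ν (c u)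
InO⇒IsOuterContent ν u pν (_ , o , k , eq , refl) = outerContentsFrom-sound 0 ν k (c u) (subst (λ S → nth S k ≡ just (c u)) (outerContents≡ ν pν) eq)

IsOuterContent⇒InO : ∀ ν u → IsPartition ν → u ∈ᵈ ν → IsOuterContent ν (c u) → InO ν u
IsOuterContent⇒InO ν u pν m oc with outerContentsFrom-complete 0 ν (c u) oc
... | (k , eq) = m , c u , k , subst (λ S → nth S k ≡ just (c u)) (sym (outerContents≡ ν pν)) eq , refl

InA⇒IsAContent : ∀ ν u → IsPartition ν → InA ν u → IsAContent ν (c u)
InA⇒IsAContent ν u pν (m , al) with ∈ᵈ-view ν u m
... | (p , q , refl , ql) = InAContents⇒IsAContentFrom 0 ν (suc q) (suc p) pν lb
       (subst₂ (λ S T → InAContents S T (c u)) (outerContents≡ ν pν) (innerContents≡ ν pν) al)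
  where
  lb : ContentLowerBound 0 ν (c u)
  lb = p , NP.<-≤-trans (s≤s z≤n) ql , cross≤⇒sub≤ 1 (suc p) (suc q) (suc p) (s≤s (NP.+-monoˡ-≤ (suc p) z≤n))

IsAContent⇒InA : ∀ ν u → IsPartition ν → u ∈ᵈ ν → IsAContent ν (c u) → InA ν u
IsAContent⇒InA ν u pν m ac = m , subst₂ (λ S T → InAContents S T (c u)) (sym (outerContents≡ ν pν)) (sym (innerContents≡ ν pν)) (IsAContentFrom⇒InAContents 0 ν (c u) pν ac)

cell : ℕ → ℕ → Cell
cell i j = (+ i , + j)

≤∞-trans : ∀ {a b c} → a ≤∞ b → b ≤∞ c → a ≤∞ c
≤∞-trans (fin≤fin p) (fin≤fin q) = fin≤fin (NP.≤-trans p q)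
≤∞-trans (fin≤fin p) (_ ≤∞∞) = _ ≤∞∞
≤∞-trans (_ ≤∞∞) (_ ≤∞∞) = _ ≤∞∞

<≤∞-trans : ∀ {a b c} → a <∞ b → b ≤∞ c → a <∞ c
<≤∞-trans (fin<fin p) (fin≤fin q) = fin<fin (NP.<-≤-trans p q)
<≤∞-trans (fin<fin p) (_ ≤∞∞) = fin<∞ _
<≤∞-trans (fin<∞ a) (_ ≤∞∞) = fin<∞ a

≤<∞-trans : ∀ {a b c} → a ≤∞ b → b <∞ c → a <∞ c
≤<∞-trans (fin≤fin p) (fin<fin q) = fin<fin (NP.≤-<-trans p q)
≤<∞-trans (fin≤fin p) (fin<∞ _) = fin<∞ _

<∞⇒≤∞ : ∀ {a b} → a <∞ b → a ≤∞ b
<∞⇒≤∞ (fin<fin p) = fin≤fin (NP.<⇒≤ p)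
<∞⇒≤∞ (fin<∞ a) = fin a ≤∞∞

<∞-irrefl : ∀ {a} → ¬ (a <∞ a)
<∞-irrefl (fin<fin p) = NP.<-irrefl refl p

fin0≤ : ∀ v → fin 0 ≤∞ v
fin0≤ (fin x) = fin≤fin z≤n
fin0≤ ∞ = fin 0 ≤∞∞

<∞? : ∀ a b → Dec (a <∞ b)
<∞? (fin a) (fin b) with a ℕ.<? b
... | yes p = yes (fin<fin p)
... | no p = no λ { (fin<fin q) → p q }
<∞? (fin a) ∞ = yes (fin<∞ a)
<∞? ∞ b = no λ ()

≮∞⇒≥ : ∀ {a b} → ¬ (a <∞ b) → b ≤∞ a
≮∞⇒≥ {fin a} {fin b} h = fin≤fin (NP.≮⇒≥ (λ p → h (fin<fin p)))
≮∞⇒≥ {fin a} {∞} h = ⊥-elim (h (fin<∞ a))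
≮∞⇒≥ {∞} {b} h = b ≤∞∞

≤∞-antisym : ∀ {a b} → a ≤∞ b → b ≤∞ a → a ≡ b
≤∞-antisym (fin≤fin p) (fin≤fin q) = cong fin (NP.≤-antisym p q)
≤∞-antisym (∞ ≤∞∞) _ = refl

fin<fin⁻ : ∀ {a b} → fin a <∞ fin b → a ℕ.< b
fin<fin⁻ (fin<fin p) = p

fin≤fin⁻ : ∀ {a b} → fin a ≤∞ fin b → a ℕ.≤ b
fin≤fin⁻ (fin≤fin p) = p

rowLenℕ-suc-≤ : ∀ ν → IsPartition ν → ∀ i → rowLenℕ ν (suc i) ℕ.≤ rowLenℕ ν i
rowLenℕ-suc-≤ [] p i = z≤n
rowLenℕ-suc-≤ (r ∷ rs) p zero = subst (ℕ._≤ r) (sym (rowLenℕ-zero≡head₀ rs)) (IsPartition-head p)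
rowLenℕ-suc-≤ (r ∷ rs) p (suc i) = rowLenℕ-suc-≤ rs (IsPartition-tail p) i

rowLenℕ-+-≤ : ∀ ν → IsPartition ν → ∀ i k → rowLenℕ ν (i ℕ.+ k) ℕ.≤ rowLenℕ ν i
rowLenℕ-+-≤ ν p i zero = NP.≤-reflexive (cong (rowLenℕ ν) (NP.+-identityʳ i))
rowLenℕ-+-≤ ν p i (suc k) = NP.≤-trans (subst (λ z → rowLenℕ ν z ℕ.≤ rowLenℕ ν (i ℕ.+ k)) (sym (NP.+-suc i k)) (rowLenℕ-suc-≤ ν p (i ℕ.+ k))) (rowLenℕ-+-≤ ν p i k)

rowLenℕ-antitone : ∀ ν → IsPartition ν → ∀ {i i'} → i ℕ.≤ i' → rowLenℕ ν i' ℕ.≤ rowLenℕ ν i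
rowLenℕ-antitone ν p {i} {i'} le = subst (λ z → rowLenℕ ν z ℕ.≤ rowLenℕ ν i) (NP.m+[n∸m]≡n le) (rowLenℕ-+-≤ ν p i (i' ℕ.∸ i))

<rowLen⇒∈ᵈ : ∀ ν i j → j ℕ.< rowLenℕ ν i → cell (suc i) (suc j) ∈ᵈ ν
<rowLen⇒∈ᵈ ν i j l = NP.<⇒<ᵇ l

∈ᵈ⇒<rowLen : ∀ ν i j → cell (suc i) (suc j) ∈ᵈ ν → j ℕ.< rowLenℕ ν i
∈ᵈ⇒<rowLen ν i j m = NP.<ᵇ⇒< j (rowLenℕ ν i) m

∈ᵈ-downClosed : ∀ ν → IsPartition ν → ∀ {i j i' j'} → cell (suc i) (suc j) ∈ᵈ ν → i' ℕ.≤ i → j' ℕ.≤ j → cell (suc i') (suc j') ∈ᵈ ν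
∈ᵈ-downClosed ν p {i} {j} {i'} {j'} m li lj = <rowLen⇒∈ᵈ ν i' j' (NP.≤-<-trans lj (NP.<-≤-trans (∈ᵈ⇒<rowLen ν i j m) (rowLenℕ-antitone ν p li)))

e-cell : ∀ i j → e (cell i j) ≡ cell i (suc j)
e-cell i j = cong (λ z → (+ i , + z)) (NP.+-comm j 1)

s-cell : ∀ i j → s (cell i j) ≡ cell (suc i) j
s-cell i j = cong (λ z → (+ z , + j)) (NP.+-comm i 1)

content-north : ∀ i j → c (cell i j) ≡ c (cell (suc i) j) + 1ℤ
content-north i j = shift (+ j) (+ i)
  where
  shift : ∀ J I → J - I ≡ (J - (1ℤ + I)) + 1ℤ
  shift = solve-∀

val-in : ∀ ν f i j → cell (suc i) (suc j) ∈ᵈ ν → val ν f (cell (suc i) (suc j)) ≡ fin (f (cell (suc i) (suc j)))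
val-in ν f i j m rewrite <ᵇ0-false i | <ᵇ0-false j | Equivalence.to BP.T-≡ m = refl

val-out : ∀ ν f i j → ¬ (cell (suc i) (suc j) ∈ᵈ ν) → val ν f (cell (suc i) (suc j)) ≡ ∞
val-out ν f i j nm rewrite <ᵇ0-false i | <ᵇ0-false j with memᵇ ν (cell (suc i) (suc j))
... | true = ⊥-elim (nm _)
... | false = refl

val-suc : ∀ ν f i j → val ν f (cell (suc i) (suc j)) ≡ (if (j <ᵇ rowLenℕ ν i) then fin (f (cell (suc i) (suc j))) else ∞)
val-suc ν f i j rewrite <ᵇ0-false i | <ᵇ0-false j = refl

val-column0 : ∀ ν f i → val ν f (cell i 0) ≡ fin 0
val-column0 ν f zero = refl
val-column0 ν f (suc i) rewrite <ᵇ0-false i = refl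

val-n : ∀ ν f i j → val ν f (n (cell i j)) ≡ val ν f (cell (ℕ.pred i) j)
val-n ν f zero j = refl
val-n ν f (suc i) j = refl

val-w : ∀ ν f i j → val ν f (w (cell i j)) ≡ val ν f (cell i (ℕ.pred j))
val-w ν f i zero = trans (lem i) (sym (val-column0 ν f i))
  where
  lem : ∀ i → val ν f (+ i , -[1+ 0 ]) ≡ fin 0
  lem zero = refl
  lem (suc i) rewrite <ᵇ0-false i = refl
val-w ν f i (suc j) = refl

val-mono-s : ∀ ν f → IsPartition ν → IsRPP ν f → ∀ i j → val ν f (cell i j) ≤∞ val ν f (cell (suc i) j)
val-mono-s ν f p rpp zero j = fin0≤ _
val-mono-s ν f p rpp (suc i) zero rewrite val-column0 ν f (suc i) = fin0≤ _
val-mono-s ν f p rpp (suc i) (suc j) with j ℕ.<? rowLenℕ ν i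
... | yes l = subst (λ z → val ν f (cell (suc i) (suc j)) ≤∞ val ν f z) (s-cell (suc i) (suc j)) (proj₂ (rpp (cell (suc i) (suc j)) (<rowLen⇒∈ᵈ ν i j l)))
... | no l rewrite val-out ν f i j (λ m → l (∈ᵈ⇒<rowLen ν i j m))
                 | val-out ν f (suc i) j (λ m → l (NP.<-≤-trans (∈ᵈ⇒<rowLen ν (suc i) j m) (rowLenℕ-suc-≤ ν p i))) = ∞ ≤∞∞

val-mono-e : ∀ ν f → IsPartition ν → IsRPP ν f → ∀ i j → val ν f (cell i j) ≤∞ val ν f (cell i (suc j))
val-mono-e ν f p rpp zero j = fin0≤ _
val-mono-e ν f p rpp (suc i) zero rewrite val-column0 ν f (suc i) = fin0≤ _
val-mono-e ν f p rpp (suc i) (suc j) with suc j ℕ.<? rowLenℕ ν i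
... | yes l = subst (λ z → val ν f (cell (suc i) (suc j)) ≤∞ val ν f z) (e-cell (suc i) (suc j)) (proj₁ (rpp (cell (suc i) (suc j)) (<rowLen⇒∈ᵈ ν i j (NP.<-trans NP.≤-refl l))))
... | no l with j ℕ.<? rowLenℕ ν i
...   | yes l' = subst (λ z → val ν f (cell (suc i) (suc j)) ≤∞ val ν f z) (e-cell (suc i) (suc j)) (proj₁ (rpp (cell (suc i) (suc j)) (<rowLen⇒∈ᵈ ν i j l')))
...   | no l' rewrite val-out ν f i j (λ m → l' (∈ᵈ⇒<rowLen ν i j m))
                 | val-out ν f i (suc j) (λ m → l (∈ᵈ⇒<rowLen ν i (suc j) m)) = ∞ ≤∞∞

IsAContent-suc : ∀ ν m n → IsAContent ν (+ m - + suc n) → IsCandContent ν (+ m - + n)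
IsAContent-suc ν m n (k , jj , a , b , eq) with suc jj ℕ.<? rowLenℕ ν k
... | yes l = inj₂ (k , suc jj , NP.<-trans a NP.≤-refl , l , cross≡⇒sub≡ m n (suc jj) (suc k) E)
  where
  E : m ℕ.+ suc k ≡ suc jj ℕ.+ n
  E = trans (sub≡⇒cross≡ m (suc n) jj (suc k) eq) (NP.+-suc jj n)
... | no l = inj₁ (k , NP.<-trans a b , cross≡⇒sub≡ m n (rowLenℕ ν k) (suc k) (trans (trans (sub≡⇒cross≡ m (suc n) jj (suc k) eq) (NP.+-suc jj n)) (cong (ℕ._+ n) L)))
  where
  L : suc jj ≡ rowLenℕ ν k
  L = NP.≤-antisym b (NP.≮⇒≥ l)

⊴-refl : ∀ u → u ⊴ u
⊴-refl u = inj₂ (refl , ZP.≤-refl)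

⊴-strict : ∀ u y → c y ℤ.< c u → u ⊴ y
⊴-strict u y l = inj₁ l

⊴⇒content≥ : ∀ u y → u ⊴ y → c y ℤ.≤ c u
⊴⇒content≥ u y (inj₁ l) = ZP.<⇒≤ l
⊴⇒content≥ u y (inj₂ (eq , _)) = ZP.≤-reflexive (sym eq)

content<⇒⋬ : ∀ v u → c v ℤ.< c u → ¬ (v ⊴ u)
content<⇒⋬ v u l (inj₁ l') = ZP.<-asym l l'
content<⇒⋬ v u l (inj₂ (eq , _)) = ZP.<-irrefl eq l

row<⇒⋬ : ∀ v u → c v ≡ c u → proj₁ v ℤ.< proj₁ u → ¬ (v ⊴ u)
row<⇒⋬ v u eq l (inj₁ l') = ZP.<-irrefl (sym eq) l'
row<⇒⋬ v u eq l (inj₂ (_ , le)) = ZP.<-irrefl refl (ZP.<-≤-trans l le)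

cand⇒w< : ∀ {ν f u} → cand ν f u → val ν f (w u) <∞ val ν f u
cand⇒w< (inj₁ (_ , l)) = l
cand⇒w< (inj₂ (_ , l , _)) = l

cand⇒∈ᵈ : ∀ {ν f u} → cand ν f u → u ∈ᵈ ν
cand⇒∈ᵈ (inj₁ (io , _)) = proj₁ io
cand⇒∈ᵈ (inj₂ (ia , _)) = proj₁ ia

-- If π(n u) = π(u), the ascent from the west persists at n u, whose content is again in 𝒪 ∪ 𝒜.
∃cand⊴ : ∀ ν f → IsPartition ν → (∀ i j → val ν f (cell i j) ≤∞ val ν f (cell (suc i) j)) →
  ∀ i j → cell (suc i) (suc j) ∈ᵈ ν → val ν f (cell (suc i) j) <∞ val ν f (cell (suc i) (suc j)) →
  IsCandContent ν (c (cell (suc i) (suc j))) →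
  Σ Cell λ u → cand ν f u × (u ⊴ cell (suc i) (suc j))
∃cand⊴ ν f pν mono i j m lt (inj₁ oc) = cell (suc i) (suc j) , inj₁ (IsOuterContent⇒InO ν (cell (suc i) (suc j)) pν m oc , lt) , ⊴-refl (cell (suc i) (suc j))
∃cand⊴ ν f pν mono i j m lt (inj₂ ac) with <∞? (val ν f (cell i (suc j))) (val ν f (cell (suc i) (suc j)))
... | yes q = cell (suc i) (suc j) , inj₂ (IsAContent⇒InA ν (cell (suc i) (suc j)) pν m ac , lt , q) , ⊴-refl (cell (suc i) (suc j))
∃cand⊴ ν f pν mono zero j m lt (inj₂ ac) | no q = ⊥-elim (q (≤<∞-trans (fin0≤ _) lt))
∃cand⊴ ν f pν mono (suc i) j m lt (inj₂ ac) | no q with ∃cand⊴ ν f pν mono i j m' lt' (IsAContent-suc ν (suc j) (suc i) ac)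
  where
  m' : cell (suc i) (suc j) ∈ᵈ ν
  m' = ∈ᵈ-downClosed ν pν m (NP.n≤1+n i) NP.≤-refl
  lt' : val ν f (cell (suc i) j) <∞ val ν f (cell (suc i) (suc j))
  lt' = ≤<∞-trans (mono (suc i) j) (<≤∞-trans lt (≮∞⇒≥ q))
... | (u , cu , le) = u , cu , ⊴-strict u (cell (suc (suc i)) (suc j)) (ZP.<-≤-trans (cross<⇒sub< (suc j) (suc (suc i)) (suc j) (suc i) (NP.+-monoʳ-< (suc j) NP.≤-refl)) (⊴⇒content≥ u (cell (suc i) (suc j)) le))

T-not-absurd : ∀ {b} → T (not b) → T b → ⊥
T-not-absurd {true} () _
T-not-absurd {false} _ ()

<-ext : ∀ a b → (∀ j → j ℕ.< a → j ℕ.< b) → (∀ j → j ℕ.< b → j ℕ.< a) → a ≡ b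
<-ext a b f g with NP.<-cmp a b
... | tri< l _ _ = ⊥-elim (NP.<-irrefl refl (g a l))
... | tri≈ _ e _ = e
... | tri> _ _ l = ⊥-elim (NP.<-irrefl refl (f b l))

outerCorner-view : ∀ lam x → OuterCorner lam x →
  Σ ℕ λ A → Σ ℕ λ B → (x ≡ cell (suc A) (suc B)) × (rowLenℕ lam A ≡ suc B) × (rowLenℕ lam (suc A) ℕ.≤ B)
outerCorner-view lam x ox with Equivalence.to (BP.T-∧ {memᵇ lam x} {not (memᵇ lam (e x)) ∧ not (memᵇ lam (s x))}) ox
... | (mx , rest) with Equivalence.to (BP.T-∧ {not (memᵇ lam (e x))} {not (memᵇ lam (s x))}) rest | ∈ᵈ-view lam x mx
...   | (ne , ns) | (A , B , refl , l) =
      A , B , refl , NP.≤-antisym (NP.≮⇒≥ (λ l' → T-not-absurd ne (subst (λ z → T (memᵇ lam z)) (sym (e-cell (suc A) (suc B))) (<rowLen⇒∈ᵈ lam A (suc B) l')))) l ,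
      NP.≮⇒≥ (λ l' → T-not-absurd ns (subst (λ z → T (memᵇ lam z)) (sym (s-cell (suc A) (suc B))) (<rowLen⇒∈ᵈ lam (suc A) B l')))

module _ (lam mu : List ℕ) (A B : ℕ)
         (H : ∀ u → (u ∈ᵈ mu) ⇔ ((u ∈ᵈ lam) × (u ≢ cell (suc A) (suc B))))
         where

  removeCorner-rowLen : ∀ k → k ≢ A → rowLenℕ mu k ≡ rowLenℕ lam k
  removeCorner-rowLen k k≢A = <-ext _ _
    (λ j l → ∈ᵈ⇒<rowLen lam k j (proj₁ (Equivalence.to (H (cell (suc k) (suc j))) (<rowLen⇒∈ᵈ mu k j l))))
    (λ j l → ∈ᵈ⇒<rowLen mu k j (Equivalence.from (H (cell (suc k) (suc j))) (<rowLen⇒∈ᵈ lam k j l , other-row)))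
    where
    other-row : ∀ {j} → cell (suc k) (suc j) ≢ cell (suc A) (suc B)
    other-row eq = k≢A (NP.suc-injective (ZP.+-injective (cong proj₁ eq)))

  removeCorner-rowLen-corner : rowLenℕ lam A ≡ suc B → rowLenℕ mu A ≡ B
  removeCorner-rowLen-corner hxA = <-ext _ _ below above
    where
    below : ∀ j → j ℕ.< rowLenℕ mu A → j ℕ.< B
    below j l with Equivalence.to (H (cell (suc A) (suc j))) (<rowLen⇒∈ᵈ mu A j l)
    ... | (ml , nx) = NP.≤∧≢⇒< (NP.≤-pred (subst (j ℕ.<_) hxA (∈ᵈ⇒<rowLen lam A j ml))) (λ eq → nx (cong (λ z → (+ suc A , + suc z)) eq))
    above : ∀ j → j ℕ.< B → j ℕ.< rowLenℕ mu A
    above j l = ∈ᵈ⇒<rowLen mu A j (Equivalence.from (H (cell (suc A) (suc j)))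
      (<rowLen⇒∈ᵈ lam A j (subst (j ℕ.<_) (sym hxA) (NP.<-trans l NP.≤-refl)) ,
       λ eq → NP.<-irrefl (NP.suc-injective (ZP.+-injective (cong proj₂ eq))) l))

-- (M + m) ∸ p is the toggle of p between M = max(π(n u), π(w u)) and m = min(π(e u), π(s u)).
toggle≤min : ∀ M m p → M ℕ.≤ p → (M ℕ.+ m) ∸ p ℕ.≤ m
toggle≤min M m p le = NP.≤-trans (NP.∸-monoˡ-≤ p (NP.+-monoˡ-≤ m le)) (NP.≤-reflexive (NP.m+n∸m≡n p m))

max≤toggle : ∀ M m p → p ℕ.≤ m → M ℕ.≤ (M ℕ.+ m) ∸ p
max≤toggle M m p le rewrite NP.+-∸-assoc M le = NP.m≤m+n M (m ∸ p)

toggle<min : ∀ M m p → M ℕ.< p → p ℕ.≤ m → (M ℕ.+ m) ∸ p ℕ.< m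
toggle<min M m p lt le rewrite NP.+-∸-assoc M le =
  subst (M ℕ.+ (m ∸ p) ℕ.<_) (NP.m+[n∸m]≡n le) (NP.+-monoˡ-< (m ∸ p) lt)

toggle-maxAt : ∀ M m p → M ≡ p → (M ℕ.+ m) ∸ p ≡ m
toggle-maxAt M m p refl = NP.m+n∸m≡n M m

toggle-minAt : ∀ M m p → m ≡ p → (M ℕ.+ m) ∸ p ≡ M
toggle-minAt M m p refl = NP.m+n∸n≡m M m

module CornerRemoval
    (lam : List ℕ) (pl : IsPartition lam) (A B : ℕ)
    (hxA : rowLenℕ lam A ≡ suc B) (hxS : rowLenℕ lam (suc A) ℕ.≤ B)
    (mu : List ℕ) (pm : IsPartition mu)
    (hmA : rowLenℕ mu A ≡ B) (hmk : ∀ k → k ≢ A → rowLenℕ mu k ≡ rowLenℕ lam k)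
    (π : Filling) (rpp : IsRPP lam π)
    (xmax : val lam π (+ suc A , + suc B) ≡ max∞ (val lam π (n (+ suc A , + suc B))) (val lam π (w (+ suc A , + suc B))))
    where
  X : Cell
  X = cell (suc A) (suc B)

  ρ : Filling
  ρ = ζ lam X π

  P R : ℕ → ℕ → ℕ∞
  P i j = val lam π (cell i j)
  R i j = val mu ρ (cell i j)

  -- π on the rectangle spanned by X, which lies in λ, with its zero boundary made explicit.
  pv : ℕ → ℕ → ℕ
  pv zero j = 0
  pv (suc i) zero = 0
  pv (suc i) (suc j) = π (cell (suc i) (suc j))

  content≡cX⇒ : ∀ i j → c (cell i j) ≡ c X → j ℕ.+ suc A ≡ suc B ℕ.+ i
  content≡cX⇒ i j e = sub≡⇒cross≡ j i (suc B) (suc A) e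

  ⇒content≡cX : ∀ i j → j ℕ.+ suc A ≡ suc B ℕ.+ i → c (cell i j) ≡ c X
  ⇒content≡cX i j e = cross≡⇒sub≡ j i (suc B) (suc A) e

  X∈λ : X ∈ᵈ lam
  X∈λ = <rowLen⇒∈ᵈ lam A B (subst (B ℕ.<_) (sym hxA) NP.≤-refl)

  P≡pv : ∀ i j → i ℕ.≤ suc A → j ℕ.≤ suc B → P i j ≡ fin (pv i j)
  P≡pv zero j li lj = refl
  P≡pv (suc i) zero li lj = val-column0 lam π (suc i)
  P≡pv (suc i) (suc j) (s≤s li) (s≤s lj) = val-in lam π i j (∈ᵈ-downClosed lam pl X∈λ li lj)

  ζ-off : ∀ u → c u ≢ c X → ρ u ≡ π u
  ζ-off u ne with c u ℤ.≟ c X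
  ... | yes e = ⊥-elim (ne e)
  ... | no _ = refl

  ζ-on : ∀ u → c u ≡ c X → ρ u ≡ (unfin (max∞ (val lam π (n u)) (val lam π (w u))) ℕ.+ unfin (min∞ (val lam π (e u)) (val lam π (s u)))) ∸ π u
  ζ-on u eq with c u ℤ.≟ c X
  ... | yes _ = refl
  ... | no ne = ⊥-elim (ne eq)

  memᵇ-μ≡λ : ∀ i j → c (cell (suc i) (suc j)) ≢ c X → (j <ᵇ rowLenℕ mu i) ≡ (j <ᵇ rowLenℕ lam i)
  memᵇ-μ≡λ i j ne with i ℕ.≟ A
  ... | no iA rewrite hmk i iA = refl
  ... | yes refl rewrite hmA | hxA with NP.<-cmp j B
  ...   | tri< l _ _ rewrite <ᵇ-true l | <ᵇ-true (NP.<-trans l NP.≤-refl) = refl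
  ...   | tri≈ _ refl _ = ⊥-elim (ne refl)
  ...   | tri> _ _ l rewrite <ᵇ-false (NP.<⇒≤ l) | <ᵇ-false {j} {suc B} l = refl

  R≡P : ∀ i j → c (cell i j) ≢ c X → R i j ≡ P i j
  R≡P zero j ne = refl
  R≡P (suc i) zero ne = trans (val-column0 mu ρ (suc i)) (sym (val-column0 lam π (suc i)))
  R≡P (suc i) (suc j) ne rewrite val-suc mu ρ i j | val-suc lam π i j | memᵇ-μ≡λ i j ne | ζ-off (cell (suc i) (suc j)) ne = refl

  diag-lt : ∀ i j → j ℕ.+ A ≡ B ℕ.+ i → i ℕ.< A → j ℕ.< B
  diag-lt i j d l with j ℕ.<? B
  ... | yes q = q
  ... | no q = ⊥-elim (NP.<-irrefl refl (NP.<-≤-trans (subst (ℕ._< B ℕ.+ A) (sym d) (NP.+-monoʳ-< B l)) (NP.+-monoˡ-≤ A (NP.≮⇒≥ q)) ))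

  diag⇒content≡cX : ∀ i j → j ℕ.+ A ≡ B ℕ.+ i → c (cell (suc i) (suc j)) ≡ c X
  diag⇒content≡cX i j d = ⇒content≡cX (suc i) (suc j) (trans (cong suc (NP.+-suc j A)) (trans (cong (λ z → suc (suc z)) d) (cong suc (sym (NP.+-suc B i)))))

  content≡cX⇒diag : ∀ i j → c (cell (suc i) (suc j)) ≡ c X → j ℕ.+ A ≡ B ℕ.+ i
  content≡cX⇒diag i j e = NP.suc-injective (NP.suc-injective (trans (sym (cong suc (NP.+-suc j A))) (trans (content≡cX⇒ (suc i) (suc j) e) (cong suc (NP.+-suc B i)))))

  diag∈λ⇒row≤A : ∀ i j → cell (suc i) (suc j) ∈ᵈ lam → j ℕ.+ A ≡ B ℕ.+ i → i ℕ.≤ A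
  diag∈λ⇒row≤A i j m d with i ℕ.≤? A
  ... | yes q = q
  ... | no q = ⊥-elim (NP.<-irrefl refl (NP.<-≤-trans (NP.+-monoʳ-< B (NP.≰⇒> q)) (NP.≤-trans (NP.≤-reflexive (sym d)) (NP.+-monoˡ-≤ A jB))))
    where
    jB : j ℕ.≤ B
    jB = NP.<⇒≤ (NP.<-≤-trans (∈ᵈ⇒<rowLen lam i j m) (NP.≤-trans (rowLenℕ-antitone lam pl (NP.≰⇒> q)) hxS))

  R-toggle : ∀ i j → j ℕ.+ A ≡ B ℕ.+ i → i ℕ.< A →
    R (suc i) (suc j) ≡ fin (((pv i (suc j) ⊔ pv (suc i) j) ℕ.+ (pv (suc i) (suc (suc j)) ⊓ pv (suc (suc i)) (suc j))) ∸ pv (suc i) (suc j))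
  R-toggle i j d l = trans (val-suc mu ρ i j) (trans (cong (λ b → if b then fin (ρ z) else ∞) memT)
      (cong fin (trans (ζ-on z (diag⇒content≡cX i j d)) (cong₂ (λ a b → (a ℕ.+ b) ∸ π z)
        (cong unfin (cong₂ max∞ (P≡pv i (suc j) (NP.≤-trans (NP.<⇒≤ l) (NP.n≤1+n A)) (s≤s (NP.<⇒≤ jB))) (P≡pv (suc i) j (s≤s (NP.<⇒≤ l)) (NP.≤-trans (NP.<⇒≤ jB) (NP.n≤1+n B)))))
        (cong unfin (cong₂ min∞ (trans (cong (val lam π) (e-cell (suc i) (suc j))) (P≡pv (suc i) (suc (suc j)) (s≤s (NP.<⇒≤ l)) (s≤s jB)))
                                 (trans (cong (val lam π) (s-cell (suc i) (suc j))) (P≡pv (suc (suc i)) (suc j) (s≤s l) (s≤s (NP.<⇒≤ jB))))))))))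
    where
    z = cell (suc i) (suc j)
    jB : j ℕ.< B
    jB = diag-lt i j d l
    memT : (j <ᵇ rowLenℕ mu i) ≡ true
    memT rewrite hmk i (NP.<⇒≢ l) = <ᵇ-true (∈ᵈ⇒<rowLen lam i j (∈ᵈ-downClosed lam pl X∈λ (NP.<⇒≤ l) (NP.<⇒≤ jB)))

  Pmono-s : ∀ i j → P i j ≤∞ P (suc i) j
  Pmono-s = val-mono-s lam π pl rpp
  Pmono-e : ∀ i j → P i j ≤∞ P i (suc j)
  Pmono-e = val-mono-e lam π pl rpp

  pv-s : ∀ i j → suc i ℕ.≤ suc A → j ℕ.≤ suc B → pv i j ℕ.≤ pv (suc i) j
  pv-s i j li lj = fin≤fin⁻ (subst₂ _≤∞_ (P≡pv i j (NP.≤-trans (NP.n≤1+n i) li) lj) (P≡pv (suc i) j li lj) (Pmono-s i j))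

  pv-e : ∀ i j → i ℕ.≤ suc A → suc j ℕ.≤ suc B → pv i j ℕ.≤ pv i (suc j)
  pv-e i j li lj = fin≤fin⁻ (subst₂ _≤∞_ (P≡pv i j li (NP.≤-trans (NP.n≤1+n j) lj)) (P≡pv i (suc j) li lj) (Pmono-e i j))

  diag∈μ⇒row<A : ∀ i j → cell (suc i) (suc j) ∈ᵈ mu → j ℕ.+ A ≡ B ℕ.+ i → i ℕ.< A
  diag∈μ⇒row<A i j m d with i ℕ.≟ A
  ... | yes refl = ⊥-elim (NP.<-irrefl (NP.+-cancelʳ-≡ A j B d) (subst (j ℕ.<_) hmA (∈ᵈ⇒<rowLen mu A j m)))
  ... | no iA = NP.≤∧≢⇒< (diag∈λ⇒row≤A i j (subst (λ r → T (j <ᵇ r)) (hmk i iA) m) d) iA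

  R-mono-s : ∀ i j → R i j ≤∞ R (suc i) j
  R-mono-s zero j = fin0≤ _
  R-mono-s (suc i) zero rewrite val-column0 mu ρ (suc i) | val-column0 mu ρ (suc (suc i)) = fin≤fin z≤n
  R-mono-s (suc i) (suc j) with j ℕ.<? rowLenℕ mu i
  ... | no l rewrite val-out mu ρ i j (λ m → l (∈ᵈ⇒<rowLen mu i j m))
                   | val-out mu ρ (suc i) j (λ m → l (NP.<-≤-trans (∈ᵈ⇒<rowLen mu (suc i) j m) (rowLenℕ-suc-≤ mu pm i))) = ∞ ≤∞∞
  ... | yes l = byUpperDiagonal (c (cell (suc i) (suc j)) ℤ.≟ c X)
    where
    byUpperDiagonal : Dec (c (cell (suc i) (suc j)) ≡ c X) → R (suc i) (suc j) ≤∞ R (suc (suc i)) (suc j)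
    byUpperDiagonal (yes e1) = subst₂ _≤∞_ (sym (R-toggle i j d iA)) (sym (trans (R≡P (suc (suc i)) (suc j) ne) (P≡pv (suc (suc i)) (suc j) (s≤s iA) (s≤s (NP.<⇒≤ jB)))))
                   (fin≤fin (NP.≤-trans (toggle≤min _ _ _ Mle) (NP.m⊓n≤n _ _)))
      where
      d = content≡cX⇒diag i j e1
      iA = diag∈μ⇒row<A i j (<rowLen⇒∈ᵈ mu i j l) d
      jB = diag-lt i j d iA
      ne : c (cell (suc (suc i)) (suc j)) ≢ c X
      ne e2 = NP.<-irrefl (content≡cX⇒diag (suc i) j e2) (subst (ℕ._< B ℕ.+ suc i) (sym d) (NP.+-monoʳ-< B NP.≤-refl))
      Mle : pv i (suc j) ⊔ pv (suc i) j ℕ.≤ pv (suc i) (suc j)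
      Mle = NP.⊔-lub (pv-s i (suc j) (s≤s (NP.<⇒≤ iA)) (s≤s (NP.<⇒≤ jB))) (pv-e (suc i) j (s≤s (NP.<⇒≤ iA)) (s≤s (NP.<⇒≤ jB)))
    byUpperDiagonal (no ne1) = byLowerDiagonal (c (cell (suc (suc i)) (suc j)) ℤ.≟ c X)
      where
      byLowerDiagonal : Dec (c (cell (suc (suc i)) (suc j)) ≡ c X) → R (suc i) (suc j) ≤∞ R (suc (suc i)) (suc j)
      byLowerDiagonal (no ne2) = subst₂ _≤∞_ (sym (R≡P (suc i) (suc j) ne1)) (sym (R≡P (suc (suc i)) (suc j) ne2)) (Pmono-s (suc i) (suc j))
      byLowerDiagonal (yes e2) with j ℕ.<? rowLenℕ mu (suc i)
      ... | no l2 = subst (R (suc i) (suc j) ≤∞_) (sym (val-out mu ρ (suc i) j (λ m → l2 (∈ᵈ⇒<rowLen mu (suc i) j m)))) (_ ≤∞∞)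
      ... | yes l2 = subst₂ _≤∞_ (sym (trans (R≡P (suc i) (suc j) ne1) (P≡pv (suc i) (suc j) (s≤s (NP.<⇒≤ (NP.<-trans NP.≤-refl iA))) (s≤s (NP.<⇒≤ jB))))) (sym (R-toggle (suc i) j d iA))
                     (fin≤fin (NP.≤-trans (NP.m≤m⊔n _ _) (max≤toggle _ _ _ mle)))
        where
        d = content≡cX⇒diag (suc i) j e2
        iA = diag∈μ⇒row<A (suc i) j (<rowLen⇒∈ᵈ mu (suc i) j l2) d
        jB = diag-lt (suc i) j d iA
        mle : pv (suc (suc i)) (suc j) ℕ.≤ pv (suc (suc i)) (suc (suc j)) ⊓ pv (suc (suc (suc i))) (suc j)
        mle = NP.⊓-glb (pv-e (suc (suc i)) (suc j) (s≤s (NP.<⇒≤ iA)) (s≤s jB)) (pv-s (suc (suc i)) (suc j) (s≤s iA) (s≤s (NP.<⇒≤ jB)))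

  cX+1≡[2+B]-[1+A] : c X + 1ℤ ≡ + suc (suc B) - + suc A
  cX+1≡[2+B]-[1+A] = sub+1≡suc-sub (suc B) (suc A)
  cX-1≡[1+B]-[2+A] : c X - 1ℤ ≡ + suc B - + suc (suc A)
  cX-1≡[1+B]-[2+A] = sub-1≡sub-suc (suc B) (suc A)

  content≡cX+1⇒ : ∀ i j → c (cell i j) ≡ c X + 1ℤ → j ℕ.+ suc A ≡ suc (suc B) ℕ.+ i
  content≡cX+1⇒ i j e = sub≡⇒cross≡ j i (suc (suc B)) (suc A) (trans e cX+1≡[2+B]-[1+A])
  ⇒content≡cX+1 : ∀ i j → j ℕ.+ suc A ≡ suc (suc B) ℕ.+ i → c (cell i j) ≡ c X + 1ℤ
  ⇒content≡cX+1 i j e = trans (cross≡⇒sub≡ j i (suc (suc B)) (suc A) e) (sym cX+1≡[2+B]-[1+A])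
  content≡cX-1⇒ : ∀ i j → c (cell i j) ≡ c X - 1ℤ → j ℕ.+ suc (suc A) ≡ suc B ℕ.+ i
  content≡cX-1⇒ i j e = sub≡⇒cross≡ j i (suc B) (suc (suc A)) (trans e cX-1≡[1+B]-[2+A])
  ⇒content≡cX-1 : ∀ i j → j ℕ.+ suc (suc A) ≡ suc B ℕ.+ i → c (cell i j) ≡ c X - 1ℤ
  ⇒content≡cX-1 i j e = trans (cross≡⇒sub≡ j i (suc B) (suc (suc A)) e) (sym cX-1≡[1+B]-[2+A])

  content-e : ∀ i j → c (cell i j) ≡ c X → c (cell i (suc j)) ≡ c X + 1ℤ
  content-e i j e = ⇒content≡cX+1 i (suc j) (cong suc (trans (content≡cX⇒ i j e) refl))
  content-s : ∀ i j → c (cell i j) ≡ c X → c (cell (suc i) j) ≡ c X - 1ℤ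
  content-s i j e = ⇒content≡cX-1 (suc i) j (trans (NP.+-suc j (suc A)) (trans (cong suc (content≡cX⇒ i j e)) (sym (NP.+-suc (suc B) i))))

  ∈λ⇒∈μ : ∀ i j → cell (suc i) (suc j) ∈ᵈ lam → c (cell (suc i) (suc j)) ≢ c X → cell (suc i) (suc j) ∈ᵈ mu
  ∈λ⇒∈μ i j m ne = subst T (sym (memᵇ-μ≡λ i j ne)) m

  ∈μ⇒∈λ : ∀ i j → cell (suc i) (suc j) ∈ᵈ mu → cell (suc i) (suc j) ∈ᵈ lam
  ∈μ⇒∈λ i j m with i ℕ.≟ A
  ... | yes refl = <rowLen⇒∈ᵈ lam A j (subst (j ℕ.<_) (sym hxA) (NP.<-trans (subst (j ℕ.<_) hmA (∈ᵈ⇒<rowLen mu A j m)) NP.≤-refl))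
  ... | no iA = subst (λ r → T (j <ᵇ r)) (hmk i iA) m

  n≢1+n : ∀ k → k ≢ suc k
  n≢1+n k e = NP.<-irrefl e NP.≤-refl

  private
    compareToA : ∀ k → k ≡ A ⊎ (suc k ≡ A ⊎ (k ≢ A × suc k ≢ A))
    compareToA k with k ℕ.≟ A
    ... | yes e = inj₁ e
    ... | no n1 with suc k ℕ.≟ A
    ...   | yes e = inj₂ (inj₁ e)
    ...   | no n2 = inj₂ (inj₂ (n1 , n2))

  IsOuterContent-λ⇒μ : ∀ d → IsOuterContent lam d → d ≢ c X → IsOuterContent mu d
  IsOuterContent-λ⇒μ d (k , l , eq) ne with compareToA k
  ... | inj₁ refl = ⊥-elim (ne (trans eq (cong (λ z → + z - + suc A) hxA)))
  ... | inj₂ (inj₁ refl) = k , subst₂ ℕ._<_ (sym hmA) (sym (hmk k (n≢1+n k))) (NP.<-trans NP.≤-refl (subst (ℕ._< rowLenℕ lam k) hxA l)) ,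
                           trans eq (cong (λ z → + z - + suc k) (sym (hmk k (n≢1+n k))))
  ... | inj₂ (inj₂ (n1 , n2)) = k , subst₂ ℕ._<_ (sym (hmk (suc k) n2)) (sym (hmk k n1)) l , trans eq (cong (λ z → + z - + suc k) (sym (hmk k n1)))

  IsOuterContent-μ⇒λ : ∀ d → IsOuterContent mu d → d ≢ c X + 1ℤ → (d ≢ c X - 1ℤ ⊎ rowLenℕ lam (suc A) ≡ B) → IsOuterContent lam d
  IsOuterContent-μ⇒λ d (k , l , eq) ne1 ne2 with compareToA k
  ... | inj₁ refl = ⊥-elim (contra ne2)
    where
    l' : rowLenℕ lam (suc A) ℕ.< B
    l' = subst₂ ℕ._<_ (hmk (suc A) (λ e → n≢1+n A (sym e))) hmA l
    contra : (d ≢ c X - 1ℤ ⊎ rowLenℕ lam (suc A) ≡ B) → ⊥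
    contra (inj₁ n) = n (trans eq (trans (cong (λ z → + z - + suc A) hmA) (trans (cross≡⇒sub≡ B (suc A) (suc B) (suc (suc A)) (NP.+-suc B (suc A))) (sym cX-1≡[1+B]-[2+A]))))
    contra (inj₂ e) = NP.<-irrefl e l'
  ... | inj₂ (inj₁ refl) with rowLenℕ lam k ℕ.≟ suc B
  ...   | yes e = ⊥-elim (ne1 (trans eq (trans (cong (λ z → + z - + suc k) (trans (hmk k (n≢1+n k)) e)) (⇒content≡cX+1 (suc k) (suc B) (cong suc (NP.+-suc B (suc k)))))))
  ...   | no n = k , subst (ℕ._< rowLenℕ lam k) (sym hxA) (NP.≤∧≢⇒< (subst (suc B ℕ.≤_) (hmk k (n≢1+n k)) (subst (ℕ._< rowLenℕ mu k) hmA l)) (λ e → n (sym e))) ,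
                trans eq (cong (λ z → + z - + suc k) (hmk k (n≢1+n k)))
  IsOuterContent-μ⇒λ d (k , l , eq) ne1 ne2 | inj₂ (inj₂ (n1 , n2)) = k , subst₂ ℕ._<_ (hmk (suc k) n2) (hmk k n1) l , trans eq (cong (λ z → + z - + suc k) (hmk k n1))

  IsAContent-λ⇒μ : ∀ d → IsAContent lam d → d ≢ c X - 1ℤ → IsAContent mu d
  IsAContent-λ⇒μ d (k , j , l1 , l2 , eq) ne with compareToA k
  ... | inj₁ refl with j ℕ.≟ B
  ...   | yes refl = ⊥-elim (ne (trans eq (trans (cross≡⇒sub≡ B (suc A) (suc B) (suc (suc A)) (NP.+-suc B (suc A))) (sym cX-1≡[1+B]-[2+A]))))
  ...   | no jB = A , j , subst (ℕ._< j) (sym (hmk (suc A) (λ e → n≢1+n A (sym e)))) l1 ,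
                  subst (j ℕ.<_) (sym hmA) (NP.≤∧≢⇒< (NP.≤-pred (subst (j ℕ.<_) hxA l2)) jB) , eq
  IsAContent-λ⇒μ d (k , j , l1 , l2 , eq) ne | inj₂ (inj₁ refl) = k , j , subst (ℕ._< j) (sym hmA) (NP.<-trans NP.≤-refl (subst (ℕ._< j) hxA l1)) ,
                  subst (j ℕ.<_) (sym (hmk k (n≢1+n k))) l2 , eq
  IsAContent-λ⇒μ d (k , j , l1 , l2 , eq) ne | inj₂ (inj₂ (n1 , n2)) = k , j , subst (ℕ._< j) (sym (hmk (suc k) n2)) l1 , subst (j ℕ.<_) (sym (hmk k n1)) l2 , eq

  IsAContent-μ⇒λ : ∀ d → IsAContent mu d → d ≢ c X + 1ℤ → IsAContent lam d
  IsAContent-μ⇒λ d (k , j , l1 , l2 , eq) ne with compareToA k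
  ... | inj₁ refl = A , j , subst (ℕ._< j) (hmk (suc A) (λ e → n≢1+n A (sym e))) l1 ,
                  subst (j ℕ.<_) (sym hxA) (NP.<-trans (subst (j ℕ.<_) hmA l2) NP.≤-refl) , eq
  ... | inj₂ (inj₁ refl) with j ℕ.≟ suc B
  ...   | yes refl = ⊥-elim (ne (trans eq (⇒content≡cX+1 (suc k) (suc B) (cong suc (NP.+-suc B (suc k))))))
  ...   | no jB = k , j , subst (ℕ._< j) (sym hxA) (NP.≤∧≢⇒< (subst (ℕ._< j) hmA l1) (λ e → jB (sym e))) ,
                  subst (j ℕ.<_) (hmk k (n≢1+n k)) l2 , eq
  IsAContent-μ⇒λ d (k , j , l1 , l2 , eq) ne | inj₂ (inj₂ (n1 , n2)) = k , j , subst (ℕ._< j) (hmk (suc k) n2) l1 , subst (j ℕ.<_) (hmk k n1) l2 , eq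

  cand-far⇔ : ∀ p q → cell (suc p) (suc q) ∈ᵈ lam →
    c (cell (suc p) (suc q)) ≢ c X - 1ℤ → c (cell (suc p) (suc q)) ≢ c X → c (cell (suc p) (suc q)) ≢ c X + 1ℤ →
    cand lam π (cell (suc p) (suc q)) ⇔ cand mu ρ (cell (suc p) (suc q))
  cand-far⇔ p q m n1 n0 n2 = mk⇔ fwd bwd
    where
    v = cell (suc p) (suc q)
    mμ : v ∈ᵈ mu
    mμ = ∈λ⇒∈μ p q m n0
    ew : R (suc p) q ≡ P (suc p) q
    ew = R≡P (suc p) q (λ e → n2 (content-e (suc p) q e))
    ev : R (suc p) (suc q) ≡ P (suc p) (suc q)
    ev = R≡P (suc p) (suc q) n0
    en : R p (suc q) ≡ P p (suc q)
    en = R≡P p (suc q) (λ e → n1 (content-s p (suc q) e))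
    fwd : cand lam π v → cand mu ρ v
    fwd (inj₁ (io , l)) = inj₁ (IsOuterContent⇒InO mu v pm mμ (IsOuterContent-λ⇒μ (c v) (InO⇒IsOuterContent lam v pl io) n0) , subst₂ _<∞_ (sym ew) (sym ev) l)
    fwd (inj₂ (ia , l , l')) = inj₂ (IsAContent⇒InA mu v pm mμ (IsAContent-λ⇒μ (c v) (InA⇒IsAContent lam v pl ia) n1) , subst₂ _<∞_ (sym ew) (sym ev) l , subst₂ _<∞_ (sym en) (sym ev) l')
    bwd : cand mu ρ v → cand lam π v
    bwd (inj₁ (io , l)) = inj₁ (IsOuterContent⇒InO lam v pl m (IsOuterContent-μ⇒λ (c v) (InO⇒IsOuterContent mu v pm io) n2 (inj₁ n1)) , subst₂ _<∞_ ew ev l)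
    bwd (inj₂ (ia , l , l')) = inj₂ (IsAContent⇒InA lam v pl m (IsAContent-μ⇒λ (c v) (InA⇒IsAContent mu v pm ia) n2) , subst₂ _<∞_ ew ev l , subst₂ _<∞_ en ev l')

  belowLen = rowLenℕ lam (suc A)

  cX-1≡B-[1+A] : + B - + suc A ≡ c X - 1ℤ
  cX-1≡B-[1+A] = trans (cross≡⇒sub≡ B (suc A) (suc B) (suc (suc A)) (NP.+-suc B (suc A))) (sym cX-1≡[1+B]-[2+A])

  ¬IsAContent-λ-cX-1 : belowLen ≡ B → ¬ IsAContent lam (c X - 1ℤ)
  ¬IsAContent-λ-cX-1 hb (k , j , l1 , l2 , eq) with NP.<-cmp k A
  ... | tri< k<A _ _ = NP.<-irrefl (sym E) lhs
    where
    E : j ℕ.+ suc (suc A) ≡ suc B ℕ.+ suc k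
    E = sub≡⇒cross≡ j (suc k) (suc B) (suc (suc A)) (trans (sym eq) cX-1≡[1+B]-[2+A])
    jb : suc (suc B) ℕ.≤ j
    jb = NP.≤-trans (s≤s (NP.≤-reflexive (sym hxA))) (NP.≤-trans (s≤s (rowLenℕ-antitone lam pl k<A)) l1)
    lhs : suc B ℕ.+ suc k ℕ.< j ℕ.+ suc (suc A)
    lhs = NP.<-≤-trans (NP.+-mono-<-≤ (NP.≤-refl {suc (suc B)}) (NP.≤-trans k<A (NP.≤-trans (NP.n≤1+n A) (NP.n≤1+n (suc A))))) (NP.+-monoˡ-≤ (suc (suc A)) jb)
  ... | tri≈ _ refl _ = NP.<-irrefl refl (NP.<-≤-trans (subst (ℕ._< j) hb l1) (NP.≤-pred (subst (j ℕ.<_) hxA l2)))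
  ... | tri> _ _ k>A = NP.<-irrefl E lhs
    where
    E : j ℕ.+ suc (suc A) ≡ suc B ℕ.+ suc k
    E = sub≡⇒cross≡ j (suc k) (suc B) (suc (suc A)) (trans (sym eq) cX-1≡[1+B]-[2+A])
    jb : j ℕ.< B
    jb = NP.<-≤-trans l2 (NP.≤-trans (rowLenℕ-antitone lam pl k>A) (NP.≤-reflexive hb))
    lhs : j ℕ.+ suc (suc A) ℕ.< suc B ℕ.+ suc k
    lhs = NP.+-mono-<-≤ (NP.<-trans jb NP.≤-refl) (s≤s k>A)

  IsAContent-λ-cX-1 : belowLen ℕ.< B → IsAContent lam (c X - 1ℤ)
  IsAContent-λ-cX-1 hb = A , B , hb , subst (B ℕ.<_) (sym hxA) NP.≤-refl , sym cX-1≡B-[1+A]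

  IsOuterContent-μ-cX-1 : belowLen ℕ.< B → IsOuterContent mu (c X - 1ℤ)
  IsOuterContent-μ-cX-1 hb = A , subst₂ ℕ._<_ (sym (hmk (suc A) NP.1+n≢n)) (sym hmA) hb , trans (sym cX-1≡B-[1+A]) (cong (λ z → + z - + suc A) (sym hmA))

  IsOuterContent-λ-cX : IsOuterContent lam (c X)
  IsOuterContent-λ-cX = A , subst (belowLen ℕ.<_) (sym hxA) (s≤s hxS) , cong (λ z → + z - + suc A) (sym hxA)

  cX+1≡[1+B]-[1+A′] : ∀ A' → A ≡ suc A' → c X + 1ℤ ≡ + suc B - + suc A'
  cX+1≡[1+B]-[1+A′] A' refl = trans cX+1≡[2+B]-[1+A] (cross≡⇒sub≡ (suc (suc B)) (suc (suc A')) (suc B) (suc A') (sym (NP.+-suc (suc B) (suc A'))))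

  content-cX+1-μ : ∀ A' → A ≡ suc A' → IsOuterContent mu (c X + 1ℤ) ⊎ (IsAContent mu (c X + 1ℤ) × suc B ℕ.< rowLenℕ lam A')
  content-cX+1-μ A' eA with rowLenℕ lam A' ℕ.≟ suc B
  ... | yes e = inj₁ (A' , subst₂ ℕ._<_ (sym hmA') (sym (trans (hmk A' A'≢) e)) NP.≤-refl ,
                     trans (cX+1≡[1+B]-[1+A′] A' eA) (cong (λ z → + z - + suc A') (sym (trans (hmk A' A'≢) e))))
    where
    A'≢ : A' ≢ A
    A'≢ e' = n≢1+n A' (trans e' eA)
    hmA' : rowLenℕ mu (suc A') ≡ B
    hmA' = trans (cong (rowLenℕ mu) (sym eA)) hmA
  ... | no ne = inj₂ ((A' , suc B , subst (ℕ._< suc B) (sym hmA') NP.≤-refl , subst (suc B ℕ.<_) (sym (hmk A' A'≢)) gt , cX+1≡[1+B]-[1+A′] A' eA) , gt)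
    where
    A'≢ : A' ≢ A
    A'≢ e' = n≢1+n A' (trans e' eA)
    hmA' : rowLenℕ mu (suc A') ≡ B
    hmA' = trans (cong (rowLenℕ mu) (sym eA)) hmA
    gt : suc B ℕ.< rowLenℕ lam A'
    gt = NP.≤∧≢⇒< (NP.≤-trans (NP.≤-reflexive (sym hxA)) (subst (λ t → rowLenℕ lam t ℕ.≤ rowLenℕ lam A') (sym eA) (rowLenℕ-suc-≤ lam pl A'))) (λ e → ne (sym e))

  cX+1≢cX : ∀ i j → c (cell i j) ≡ c X + 1ℤ → c (cell i j) ≢ c X
  cX+1≢cX i j e1 e0 = NP.<-irrefl (trans (sym (content≡cX⇒ i j e0)) (content≡cX+1⇒ i j e1)) NP.≤-refl

  cX-1≢cX : ∀ i j → c (cell i j) ≡ c X - 1ℤ → c (cell i j) ≢ c X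
  cX-1≢cX i j e1 e0 = NP.<-irrefl (trans (sym (content≡cX-1⇒ i j e1)) (trans (NP.+-suc j (suc A)) (cong suc (content≡cX⇒ i j e0)))) NP.≤-refl

  cX-1≢cX+1 : ∀ i j → c (cell i j) ≡ c X - 1ℤ → c (cell i j) ≢ c X + 1ℤ
  cX-1≢cX+1 i j e1 e2 = NP.<-irrefl (sym E) (s≤s (NP.n≤1+n _))
    where
    E : suc (suc (suc B) ℕ.+ i) ≡ suc B ℕ.+ i
    E = trans (sym (cong suc (content≡cX+1⇒ i j e2))) (trans (sym (NP.+-suc j (suc A))) (content≡cX-1⇒ i j e1))

  content-n : ∀ i j → c (cell (suc i) j) ≡ c X → c (cell i j) ≡ c X + 1ℤ
  content-n i j e = ⇒content≡cX+1 i j (trans (content≡cX⇒ (suc i) j e) (NP.+-suc (suc B) i))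

  content≡cX-1⇒diag : ∀ i j → c (cell (suc i) (suc j)) ≡ c X - 1ℤ → suc (j ℕ.+ A) ≡ B ℕ.+ i
  content≡cX-1⇒diag i j e = NP.suc-injective (NP.suc-injective (trans (sym (trans (cong suc (NP.+-suc j (suc A))) (cong (suc ∘ suc) (NP.+-suc j A)))) (trans (content≡cX-1⇒ (suc i) (suc j) e) (cong suc (NP.+-suc B i)))))
    where open import Function using (_∘_)

  content≡cX+1⇒diag : ∀ i j → c (cell (suc i) (suc j)) ≡ c X + 1ℤ → j ℕ.+ A ≡ suc (B ℕ.+ i)
  content≡cX+1⇒diag i j e = NP.suc-injective (NP.suc-injective (trans (sym (cong suc (NP.+-suc j A))) (trans (content≡cX+1⇒ (suc i) (suc j) e) (cong (λ z → suc (suc z)) (NP.+-suc B i)))))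

  cX+1∈λ⇒row<A : ∀ i j → cell (suc i) (suc j) ∈ᵈ lam → c (cell (suc i) (suc j)) ≡ c X + 1ℤ → i ℕ.< A
  cX+1∈λ⇒row<A i j m e with i ℕ.<? A
  ... | yes l = l
  ... | no l = ⊥-elim (NP.<-irrefl refl (NP.<-≤-trans (∈ᵈ⇒<rowLen lam i j m) (NP.≤-trans (rowLenℕ-antitone lam pl (NP.≮⇒≥ l)) (NP.≤-trans (NP.≤-reflexive hxA) jb))))
    where
    jb : suc B ℕ.≤ j
    jb = NP.+-cancelʳ-≤ A (suc B) j (subst (suc B ℕ.+ A ℕ.≤_) (sym (content≡cX+1⇒diag i j e)) (s≤s (NP.+-monoʳ-≤ B (NP.≮⇒≥ l))))

  cX-1∈λ⇒row≤1+A : ∀ i j → cell (suc i) (suc j) ∈ᵈ lam → c (cell (suc i) (suc j)) ≡ c X - 1ℤ → i ℕ.≤ suc A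
  cX-1∈λ⇒row≤1+A i j m e with i ℕ.≤? suc A
  ... | yes l = l
  ... | no l = ⊥-elim (NP.<-irrefl refl (NP.<-≤-trans (∈ᵈ⇒<rowLen lam i j m) (NP.≤-trans (rowLenℕ-antitone lam pl (NP.<⇒≤ (NP.≰⇒> l))) (NP.≤-trans hxS jb))))
    where
    jb : B ℕ.≤ j
    jb = NP.+-cancelʳ-≤ (suc A) B j (subst (B ℕ.+ suc A ℕ.≤_) (trans (sym (content≡cX-1⇒diag i j e)) (sym (NP.+-suc j A))) (NP.+-monoʳ-≤ B (NP.<⇒≤ (NP.≰⇒> l))))

  <⇒≡suc : ∀ {i k} → i ℕ.< k → Σ ℕ λ k' → k ≡ suc k'
  <⇒≡suc (s≤s _) = _ , refl

  ∃cand-μ-above-cX+1 : ∀ i j → cell (suc i) (suc j) ∈ᵈ mu → c (cell (suc i) (suc j)) ≡ c X + 1ℤ → R (suc i) j <∞ R (suc i) (suc j) →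
    Σ Cell λ u → cand mu ρ u × (c X + 1ℤ ℤ.≤ c u)
  ∃cand-μ-above-cX+1 i j m e lt with <⇒≡suc (cX+1∈λ⇒row<A i j (∈μ⇒∈λ i j m) e)
  ... | (A' , eA) with ∃cand⊴ mu ρ pm R-mono-s i j m lt (subst (IsCandContent mu) (sym e) (map₂ proj₁ (content-cX+1-μ A' eA)))
  ... | (u , cu , le) = u , cu , subst (ℤ._≤ c u) e (⊴⇒content≥ u (cell (suc i) (suc j)) le)

  cX-1<cX+1 : c X - 1ℤ ℤ.< c X + 1ℤ
  cX-1<cX+1 = subst₂ ℤ._<_ (sym cX-1≡[1+B]-[2+A]) (sym cX+1≡[2+B]-[1+A]) (cross<⇒sub< (suc B) (suc (suc A)) (suc (suc B)) (suc A) (NP.+-mono-< (NP.n<1+n (suc B)) (NP.n<1+n (suc A))))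

  CandLowerBound : Cell → Set
  CandLowerBound v = ∀ u → cand mu ρ u → v ⊴ u

  ¬CandLowerBound-cX-1 : ∀ v → c v ≡ c X - 1ℤ → CandLowerBound v → Σ Cell (λ u → cand mu ρ u × (c X + 1ℤ ℤ.≤ c u)) → ⊥
  ¬CandLowerBound-cX-1 v ev mn (u , cu , le) = content<⇒⋬ v u (subst (ℤ._< c u) (sym ev) (ZP.<-≤-trans cX-1<cX+1 le)) (mn u cu)

  minCand-μ-n-plateau-absurd : ∀ p' q → q ℕ.+ A ≡ B ℕ.+ p' → p' ℕ.< A → q ℕ.< B → pv p' (suc q) ≡ pv (suc p') (suc q) → pv (suc p') q ℕ.< pv p' (suc q) →
    ∀ v → c v ≡ c X - 1ℤ → CandLowerBound v → ⊥
  minCand-μ-n-plateau-absurd zero q d0 pA qB e1 l1 v ev mn = NP.n≮0 l1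
  minCand-μ-n-plateau-absurd (suc p'') zero d0 pA qB e1 l1 v ev mn = ¬CandLowerBound-cX-1 v ev mn (∃cand-μ-above-cX+1 p'' 0 my ey lt)
    where
    ey = content-n (suc p'') (suc zero) (diag⇒content≡cX (suc p'') zero d0)
    my = ∈λ⇒∈μ p'' 0 (∈ᵈ-downClosed lam pl X∈λ (NP.<⇒≤ (NP.<-trans NP.≤-refl pA)) z≤n) (cX+1≢cX (suc p'') 1 ey)
    lt : R (suc p'') 0 <∞ R (suc p'') 1
    lt = subst₂ _<∞_ (sym (val-column0 mu ρ (suc p''))) (sym (trans (R≡P (suc p'') 1 (cX+1≢cX (suc p'') 1 ey)) (P≡pv (suc p'') 1 (s≤s (NP.<⇒≤ (NP.<-trans NP.≤-refl pA))) (s≤s z≤n)))) (fin<fin (NP.≤-<-trans z≤n l1))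
  minCand-μ-n-plateau-absurd (suc p'') (suc q') d0 pA qB e1 l1 v ev mn = ¬CandLowerBound-cX-1 v ev mn (∃cand-μ-above-cX+1 p'' (suc q') my ey lt)
    where
    pA' : p'' ℕ.< A
    pA' = NP.<-trans NP.≤-refl pA
    d0' : q' ℕ.+ A ≡ B ℕ.+ p''
    d0' = NP.suc-injective (trans d0 (NP.+-suc B p''))
    qB' : q' ℕ.< B
    qB' = diag-lt p'' q' d0' pA'
    ey = content-n (suc p'') (suc (suc q')) (diag⇒content≡cX (suc p'') (suc q') d0)
    my = ∈λ⇒∈μ p'' (suc q') (∈ᵈ-downClosed lam pl X∈λ (NP.<⇒≤ pA') (NP.<⇒≤ qB)) (cX+1≢cX (suc p'') (suc (suc q')) ey)
    Mle : pv p'' (suc q') ⊔ pv (suc p'') q' ℕ.≤ pv (suc p'') (suc q')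
    Mle = NP.⊔-lub (pv-s p'' (suc q') (s≤s (NP.<⇒≤ pA')) (s≤s (NP.<⇒≤ qB'))) (pv-e (suc p'') q' (s≤s (NP.<⇒≤ pA')) (s≤s (NP.<⇒≤ qB')))
    lt : R (suc p'') (suc q') <∞ R (suc p'') (suc (suc q'))
    lt = subst₂ _<∞_ (sym (R-toggle p'' q' d0' pA')) (sym (trans (R≡P (suc p'') (suc (suc q')) (cX+1≢cX (suc p'') (suc (suc q')) ey)) (P≡pv (suc p'') (suc (suc q')) (s≤s (NP.<⇒≤ pA')) (s≤s (NP.<⇒≤ qB)))))
           (fin<fin (NP.≤-<-trans (NP.≤-trans (toggle≤min _ _ _ Mle) (NP.m⊓n≤n _ _)) l1))

  -- Otherwise π(n v) = π(v), so ρ(n v) = max(π(n (n v)), π(w (n v))); an ascent of ρ into e (n v),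
  -- or one row higher, gives a candidate of content c X + 1 before v.
  minCand-μ⇒n-ascent : ∀ p q → cell (suc p) (suc q) ∈ᵈ lam → c (cell (suc p) (suc q)) ≡ c X - 1ℤ → CandLowerBound (cell (suc p) (suc q)) →
    P (suc p) q <∞ P (suc p) (suc q) → P p (suc q) <∞ P (suc p) (suc q)
  minCand-μ⇒n-ascent zero q m e mn lw = ≤<∞-trans (fin0≤ _) lw
  minCand-μ⇒n-ascent (suc p') q m e mn lw with <∞? (P (suc p') (suc q)) (P (suc (suc p')) (suc q))
  ... | yes r = r
  ... | no nl = ⊥-elim main
    where
    v = cell (suc (suc p')) (suc q)
    d0 : q ℕ.+ A ≡ B ℕ.+ p'
    d0 = NP.suc-injective (trans (content≡cX-1⇒diag (suc p') q e) (NP.+-suc B p'))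
    pA : p' ℕ.< A
    pA with p' ℕ.≟ A
    ... | no ne = NP.≤∧≢⇒< (NP.≤-pred (cX-1∈λ⇒row≤1+A (suc p') q m e)) ne
    ... | yes refl = ⊥-elim (NP.<-irrefl refl (NP.<-≤-trans (subst (ℕ._< belowLen) (NP.+-cancelʳ-≡ p' q B d0) (∈ᵈ⇒<rowLen lam (suc p') q m)) hxS))
    qB : q ℕ.< B
    qB = diag-lt p' q d0 pA
    sA1 = s≤s (NP.<⇒≤ pA)
    pu = pv (suc p') (suc q)
    pvv = pv (suc (suc p')) (suc q)
    pwv = pv (suc (suc p')) q
    pwu = pv (suc p') q
    pnu = pv p' (suc q)
    peu = pv (suc p') (suc (suc q))
    lw' : pwv ℕ.< pvv
    lw' = fin<fin⁻ (subst₂ _<∞_ (P≡pv (suc (suc p')) q (s≤s pA) (NP.≤-trans (NP.<⇒≤ qB) (NP.n≤1+n B))) (P≡pv (suc (suc p')) (suc q) (s≤s pA) (s≤s (NP.<⇒≤ qB))) lw)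
    nl' : pvv ℕ.≤ pu
    nl' = fin≤fin⁻ (subst₂ _≤∞_ (P≡pv (suc (suc p')) (suc q) (s≤s pA) (s≤s (NP.<⇒≤ qB))) (P≡pv (suc p') (suc q) sA1 (s≤s (NP.<⇒≤ qB))) (≮∞⇒≥ nl))
    pue : pu ≡ pvv
    pue = NP.≤-antisym (pv-s (suc p') (suc q) (s≤s pA) (s≤s (NP.<⇒≤ qB))) nl'
    ue : pu ℕ.≤ peu
    ue = pv-e (suc p') (suc q) sA1 (s≤s qB)
    wuv : pwu ℕ.≤ pwv
    wuv = pv-s (suc p') q (s≤s pA) (NP.≤-trans (NP.<⇒≤ qB) (NP.n≤1+n B))
    nuu : pnu ℕ.≤ pu
    nuu = pv-s p' (suc q) sA1 (s≤s (NP.<⇒≤ qB))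
    wu<u : pwu ℕ.< pu
    wu<u = NP.≤-<-trans wuv (subst (pwv ℕ.<_) (sym pue) lw')
    Ru : R (suc p') (suc q) ≡ fin (pnu ⊔ pwu)
    Ru = trans (R-toggle p' q d0 pA) (cong fin (toggle-minAt _ _ _ (trans (NP.m≥n⇒m⊓n≡n (subst (ℕ._≤ peu) pue ue)) (sym pue))))
    main : ⊥
    main with pnu ℕ.<? peu
    ... | yes l1 = ¬CandLowerBound-cX-1 v e mn (∃cand-μ-above-cX+1 p' (suc q) my ey lt)
      where
      ey = content-e (suc p') (suc q) (diag⇒content≡cX p' q d0)
      my = ∈λ⇒∈μ p' (suc q) (∈ᵈ-downClosed lam pl X∈λ (NP.<⇒≤ pA) qB) (cX+1≢cX (suc p') (suc (suc q)) ey)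
      lt : R (suc p') (suc q) <∞ R (suc p') (suc (suc q))
      lt = subst₂ _<∞_ (sym Ru) (sym (trans (R≡P (suc p') (suc (suc q)) (cX+1≢cX (suc p') (suc (suc q)) ey)) (P≡pv (suc p') (suc (suc q)) sA1 (s≤s qB))))
             (fin<fin (NP.⊔-lub l1 (NP.<-≤-trans wu<u ue)))
    ... | no l1 = minCand-μ-n-plateau-absurd p' q d0 pA qB (NP.≤-antisym nuu (NP.≤-trans ue (NP.≮⇒≥ l1))) (subst (pwu ℕ.<_) (sym (NP.≤-antisym nuu (NP.≤-trans ue (NP.≮⇒≥ l1)))) wu<u) v e mn

  cand-cX-1 : ∀ p q → cell (suc p) (suc q) ∈ᵈ lam → c (cell (suc p) (suc q)) ≡ c X - 1ℤ →
    (cand lam π (cell (suc p) (suc q)) → cand mu ρ (cell (suc p) (suc q))) × (IsMinCand mu ρ (cell (suc p) (suc q)) → cand lam π (cell (suc p) (suc q)))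
  cand-cX-1 p q m e = go (NP.m≤n⇒m<n∨m≡n hxS)
    where
    v = cell (suc p) (suc q)
    ne0 = cX-1≢cX (suc p) (suc q) e
    ne+ = cX-1≢cX+1 (suc p) (suc q) e
    mμ = ∈λ⇒∈μ p q m ne0
    ew : R (suc p) q ≡ P (suc p) q
    ew = R≡P (suc p) q (λ e0 → ne+ (content-e (suc p) q e0))
    ev : R (suc p) (suc q) ≡ P (suc p) (suc q)
    ev = R≡P (suc p) (suc q) ne0
    go : belowLen ℕ.< B ⊎ belowLen ≡ B → (cand lam π v → cand mu ρ v) × (IsMinCand mu ρ v → cand lam π v)
    go (inj₂ hb) = fwd , bwd
      where
      fwd : cand lam π v → cand mu ρ v
      fwd (inj₁ (io , l)) = inj₁ (IsOuterContent⇒InO mu v pm mμ (IsOuterContent-λ⇒μ (c v) (InO⇒IsOuterContent lam v pl io) ne0) , subst₂ _<∞_ (sym ew) (sym ev) l)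
      fwd (inj₂ (ia , _)) = ⊥-elim (¬IsAContent-λ-cX-1 hb (subst (IsAContent lam) e (InA⇒IsAContent lam v pl ia)))
      bwd : IsMinCand mu ρ v → cand lam π v
      bwd (inj₁ (io , l) , _) = inj₁ (IsOuterContent⇒InO lam v pl m (IsOuterContent-μ⇒λ (c v) (InO⇒IsOuterContent mu v pm io) ne+ (inj₂ hb)) , subst₂ _<∞_ ew ev l)
      bwd (inj₂ (ia , _) , _) = ⊥-elim (¬IsAContent-λ-cX-1 hb (subst (IsAContent lam) e (IsAContent-μ⇒λ (c v) (InA⇒IsAContent mu v pm ia) ne+)))
    go (inj₁ hb) = fwd , bwd
      where
      fwd : cand lam π v → cand mu ρ v
      fwd cv = inj₁ (IsOuterContent⇒InO mu v pm mμ (subst (IsOuterContent mu) (sym e) (IsOuterContent-μ-cX-1 hb)) , subst₂ _<∞_ (sym ew) (sym ev) (cand⇒w< {lam} {π} {v} cv))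
      bwd : IsMinCand mu ρ v → cand lam π v
      bwd (cv , mn) = inj₂ (IsAContent⇒InA lam v pl m (subst (IsAContent lam) (sym e) (IsAContent-λ-cX-1 hb)) , lw , minCand-μ⇒n-ascent p q m e mn lw)
        where
        lw : P (suc p) q <∞ P (suc p) (suc q)
        lw = subst₂ _<∞_ ew ev (cand⇒w< {mu} {ρ} {v} cv)

  cX+2 : ℕ → ℤ
  cX+2 A' = + suc (suc B) - + suc A'

  content-cX+2-λ : ∀ A' → A ≡ suc A' → suc B ℕ.< rowLenℕ lam A' → IsCandContent lam (cX+2 A')
  content-cX+2-λ A' eA gt with rowLenℕ lam A' ℕ.≟ suc (suc B)
  ... | yes e = inj₁ (A' , subst₂ ℕ._<_ (sym (trans (cong (rowLenℕ lam) (sym eA)) hxA)) (sym e) NP.≤-refl , cong (λ z → + z - + suc A') (sym e))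
  ... | no ne = inj₂ (A' , suc (suc B) , subst (ℕ._< suc (suc B)) (sym (trans (cong (rowLenℕ lam) (sym eA)) hxA)) NP.≤-refl , NP.≤∧≢⇒< gt (λ e → ne (sym e)) , refl)

  cX<cX+2 : ∀ A' → A ≡ suc A' → c X ℤ.< cX+2 A'
  cX<cX+2 A' refl = cross<⇒sub< (suc B) (suc (suc A')) (suc (suc B)) (suc A') (NP.+-mono-< (NP.n<1+n (suc B)) (NP.n<1+n (suc A')))

  InO-sameContent : ∀ ν u u' → IsPartition ν → InO ν u → u' ∈ᵈ ν → c u' ≡ c u → InO ν u'
  InO-sameContent ν u u' pν io m e = IsOuterContent⇒InO ν u' pν m (subst (IsOuterContent ν) (sym e) (InO⇒IsOuterContent ν u pν io))

  InA-sameContent : ∀ ν u u' → IsPartition ν → InA ν u → u' ∈ᵈ ν → c u' ≡ c u → InA ν u'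
  InA-sameContent ν u u' pν ia m e = IsAContent⇒InA ν u' pν m (subst (IsAContent ν) (sym e) (InA⇒IsAContent ν u pν ia))

  ¬ascent-λ-cX+2 : ∀ A' → A ≡ suc A' → suc B ℕ.< rowLenℕ lam A' → ∀ i j → cell (suc i) (suc j) ∈ᵈ lam → c (cell (suc i) (suc j)) ≡ cX+2 A' →
    P (suc i) j <∞ P (suc i) (suc j) → ∀ v → c v ≡ c X → (∀ u → cand lam π u → v ⊴ u) → ⊥
  ¬ascent-λ-cX+2 A' eA gt i j m e lt v ev mn with ∃cand⊴ lam π pl Pmono-s i j m lt (subst (IsCandContent lam) (sym e) (content-cX+2-λ A' eA gt))
  ... | (u , cu , le) = content<⇒⋬ v u (subst (ℤ._< c u) (sym ev) (ZP.<-≤-trans (cX<cX+2 A' eA) (subst (ℤ._≤ c u) e (⊴⇒content≥ u (cell (suc i) (suc j)) le)))) (mn u cu)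

  cX+2≢cX : ∀ A' → A ≡ suc A' → ∀ u → c u ≡ cX+2 A' → c u ≢ c X
  cX+2≢cX A' eA u e1 e0 = ZP.<-irrefl (trans (sym e0) e1) (cX<cX+2 A' eA)

  P<P⇒pv<pv : ∀ p q → P (suc p) q <∞ P (suc p) (suc q) → p ℕ.≤ A → q ℕ.≤ B → pv (suc p) q ℕ.< pv (suc p) (suc q)
  P<P⇒pv<pv p q lw pA qB = fin<fin⁻ (subst₂ _<∞_ (P≡pv (suc p) q (s≤s pA) (NP.≤-trans qB (NP.n≤1+n B))) (P≡pv (suc p) (suc q) (s≤s pA) (s≤s qB)) lw)

  fin-injective : ∀ {a b} → fin a ≡ fin b → a ≡ b
  fin-injective refl = refl

  -- If π(n y) ≥ π(y) for y = cell (suc i) (suc j), then n y has an ascent from the west on the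
  -- diagonal c X + 2, which yields a candidate before v.
  cX+1-north-ascent : ∀ A' → A ≡ suc A' → suc B ℕ.< rowLenℕ lam A' →
    ∀ v → c v ≡ c X → (∀ u → cand lam π u → v ⊴ u) →
    ∀ i j → cell (suc i) (suc j) ∈ᵈ lam → c (cell (suc i) (suc j)) ≡ c X + 1ℤ →
    P i j <∞ P (suc i) (suc j) → R i (suc j) <∞ R (suc i) (suc j)
  cX+1-north-ascent A' eA gt v ev mn i j m ey lt =
    subst₂ _<∞_ (sym (R≡P i (suc j) (cX+2≢cX A' eA (cell i (suc j)) north-content))) (sym (R≡P (suc i) (suc j) (cX+1≢cX (suc i) (suc j) ey)))
      (north i m north-content lt)
    where
    north-content : c (cell i (suc j)) ≡ cX+2 A'
    north-content = trans (content-north i (suc j))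
      (trans (cong (_+ 1ℤ) (trans ey (cX+1≡[1+B]-[1+A′] A' eA))) (sub+1≡suc-sub (suc B) (suc A')))
    north : ∀ i → cell (suc i) (suc j) ∈ᵈ lam → c (cell i (suc j)) ≡ cX+2 A' →
      P i j <∞ P (suc i) (suc j) → P i (suc j) <∞ P (suc i) (suc j)
    north zero _ _ lt = lt
    north (suc i') m eK lt with <∞? (P (suc i') (suc j)) (P (suc (suc i')) (suc j))
    ... | yes r = r
    ... | no r = ⊥-elim (¬ascent-λ-cX+2 A' eA gt i' j (∈ᵈ-downClosed lam pl m (NP.n≤1+n i') NP.≤-refl) eK (<≤∞-trans lt (≮∞⇒≥ r)) v ev mn)

  cX+1-cand-μ : ∀ v → c v ≡ c X → (∀ u → cand lam π u → v ⊴ u) →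
    ∀ i j → cell (suc i) (suc j) ∈ᵈ lam → c (cell (suc i) (suc j)) ≡ c X + 1ℤ →
    R (suc i) j <∞ R (suc i) (suc j) → P i j <∞ P (suc i) (suc j) → cand mu ρ (cell (suc i) (suc j))
  cX+1-cand-μ v ev mn i j m ey west nw with <⇒≡suc (cX+1∈λ⇒row<A i j m ey)
  ... | (A' , eA) = byClass (content-cX+1-μ A' eA)
    where
    y = cell (suc i) (suc j)
    my : y ∈ᵈ mu
    my = ∈λ⇒∈μ i j m (cX+1≢cX (suc i) (suc j) ey)
    byClass : IsOuterContent mu (c X + 1ℤ) ⊎ (IsAContent mu (c X + 1ℤ) × suc B ℕ.< rowLenℕ lam A') → cand mu ρ y
    byClass (inj₁ o) = inj₁ (IsOuterContent⇒InO mu y pm my (subst (IsOuterContent mu) (sym ey) o) , west)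
    byClass (inj₂ (a , gt)) = inj₂ (IsAContent⇒InA mu y pm my (subst (IsAContent mu) (sym ey) a) , west , cX+1-north-ascent A' eA gt v ev mn i j m ey nw)

  n-cand-μ : ∀ p q → cell (suc p) (suc q) ∈ᵈ lam → q ℕ.+ A ≡ B ℕ.+ p → p ℕ.≤ A → q ℕ.≤ B →
    (∀ u → cand lam π u → cell (suc p) (suc q) ⊴ u) →
    P (suc p) q <∞ P (suc p) (suc q) → P (suc p) (suc q) ≡ P p (suc q) → cand mu ρ (cell p (suc q))
  n-cand-μ zero q m d0 pA qB mn lw eqv = ⊥-elim (<∞-irrefl (≤<∞-trans (fin0≤ _) (subst (P 1 q <∞_) eqv lw)))
  n-cand-μ (suc p') q m d0 pA qB mn lw eqv∞ =
    cX+1-cand-μ v (diag⇒content≡cX (suc p') q d0) mn p' q (∈ᵈ-downClosed lam pl X∈λ (NP.<⇒≤ pA) qB) ey (ltq q refl) north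
    where
    v = cell (suc (suc p')) (suc q)
    lw' : pv (suc (suc p')) q ℕ.< pv (suc (suc p')) (suc q)
    lw' = P<P⇒pv<pv (suc p') q lw pA qB
    eqv : pv (suc (suc p')) (suc q) ≡ pv (suc p') (suc q)
    eqv = fin-injective (trans (sym (P≡pv (suc (suc p')) (suc q) (s≤s pA) (s≤s qB))) (trans eqv∞ (P≡pv (suc p') (suc q) (s≤s (NP.<⇒≤ pA)) (s≤s qB))))
    ey : c (cell (suc p') (suc q)) ≡ c X + 1ℤ
    ey = content-n (suc p') (suc q) (diag⇒content≡cX (suc p') q d0)
    Ry : R (suc p') (suc q) ≡ fin (pv (suc p') (suc q))
    Ry = trans (R≡P (suc p') (suc q) (cX+1≢cX (suc p') (suc q) ey)) (P≡pv (suc p') (suc q) (s≤s (NP.<⇒≤ pA)) (s≤s qB))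
    ltq : ∀ q' → q ≡ q' → R (suc p') q' <∞ R (suc p') (suc q)
    ltq zero refl = subst₂ _<∞_ (sym (val-column0 mu ρ (suc p'))) (sym Ry) (fin<fin (NP.≤-<-trans z≤n (subst (pv (suc (suc p')) 0 ℕ.<_) eqv lw')))
    ltq (suc q') refl = subst₂ _<∞_ (sym (R-toggle p' q' d' pA)) (sym Ry) (fin<fin (NP.≤-<-trans (NP.≤-trans (toggle≤min _ _ _ Mle) (NP.m⊓n≤n _ _)) (subst (pv (suc (suc p')) (suc q') ℕ.<_) eqv lw')))
      where
      d' : q' ℕ.+ A ≡ B ℕ.+ p'
      d' = NP.suc-injective (trans d0 (NP.+-suc B p'))
      qB' : q' ℕ.< B
      qB' = diag-lt p' q' d' pA
      Mle : pv p' (suc q') ⊔ pv (suc p') q' ℕ.≤ pv (suc p') (suc q')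
      Mle = NP.⊔-lub (pv-s p' (suc q') (s≤s (NP.<⇒≤ pA)) (s≤s (NP.<⇒≤ qB'))) (pv-e (suc p') q' (s≤s (NP.<⇒≤ pA)) (s≤s (NP.<⇒≤ qB')))
    north : P p' q <∞ P (suc p') (suc q)
    north = ≤<∞-trans (Pmono-s p' q) (≤<∞-trans (Pmono-s (suc p') q) (subst (P (suc (suc p')) q <∞_) eqv∞ lw))

  ¬e-cand-μ : ∀ p q → cell (suc p) (suc q) ∈ᵈ lam → q ℕ.+ A ≡ B ℕ.+ p → p ℕ.≤ A → q ℕ.≤ B →
    (∀ u → cand lam π u → cell (suc p) (suc q) ⊴ u) →
    P (suc p) q <∞ P (suc p) (suc q) → P (suc p) (suc q) ≡ P p (suc q) → ¬ cand mu ρ (cell (suc p) (suc (suc q)))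
  ¬e-cand-μ p q m d0 pA qB mn lw eqv∞ ce with p ℕ.≟ A
  ... | yes refl = NP.<-irrefl (NP.+-cancelʳ-≡ p q B d0) (NP.<-trans NP.≤-refl (subst (suc q ℕ.<_) hmA (∈ᵈ⇒<rowLen mu p (suc q) (cand⇒∈ᵈ {mu} {ρ} {cell (suc p) (suc (suc q))} ce))))
  ... | no ne = row<⇒⋬ (cell (suc p) (suc q)) z (trans (diag⇒content≡cX p q d0) (sym (diag⇒content≡cX (suc p) (suc q) d0''))) (ℤ.+<+ NP.≤-refl) (mn z cz)
    where
    pA' : p ℕ.< A
    pA' = NP.≤∧≢⇒< pA ne
    qB' : q ℕ.< B
    qB' = diag-lt p q d0 pA'
    d0'' : suc q ℕ.+ A ≡ B ℕ.+ suc p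
    d0'' = trans (cong suc d0) (sym (NP.+-suc B p))
    z = cell (suc (suc p)) (suc (suc q))
    pvv = pv (suc p) (suc q)
    pev = pv (suc p) (suc (suc q))
    psv = pv (suc (suc p)) (suc q)
    lw' : pv (suc p) q ℕ.< pvv
    lw' = P<P⇒pv<pv p q lw pA qB
    eqv : pvv ≡ pv p (suc q)
    eqv = fin-injective (trans (sym (P≡pv (suc p) (suc q) (s≤s pA) (s≤s qB))) (trans eqv∞ (P≡pv p (suc q) (NP.≤-trans pA (NP.n≤1+n A)) (s≤s qB))))
    ey = content-e (suc p) (suc q) (diag⇒content≡cX p q d0)
    lt : R (suc p) (suc q) <∞ R (suc p) (suc (suc q))
    lt = cand⇒w< {mu} {ρ} {cell (suc p) (suc (suc q))} ce
    Mv : pv p (suc q) ⊔ pv (suc p) q ≡ pvv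
    Mv = trans (NP.m≥n⇒m⊔n≡m (NP.<⇒≤ (subst (pv (suc p) q ℕ.<_) eqv lw'))) (sym eqv)
    m<e : pev ⊓ psv ℕ.< pev
    m<e = fin<fin⁻ (subst₂ _<∞_ (trans (R-toggle p q d0 pA') (cong fin (toggle-maxAt _ _ _ Mv)))
             (trans (R≡P (suc p) (suc (suc q)) (cX+1≢cX (suc p) (suc (suc q)) ey)) (P≡pv (suc p) (suc (suc q)) (s≤s pA) (s≤s qB'))) lt)
    s<e : psv ℕ.< pev
    s<e with pev ℕ.≤? psv
    ... | yes le = ⊥-elim (NP.<-irrefl (NP.m≤n⇒m⊓n≡m le) m<e)
    ... | no le = NP.≰⇒> le
    mz : z ∈ᵈ lam
    mz = ∈ᵈ-downClosed lam pl X∈λ pA' qB'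
    cz : cand lam π z
    cz = inj₁ (IsOuterContent⇒InO lam z pl mz (subst (IsOuterContent lam) (sym (diag⇒content≡cX (suc p) (suc q) d0'')) IsOuterContent-λ-cX) ,
               subst₂ _<∞_ (sym (P≡pv (suc (suc p)) (suc q) (s≤s pA') (s≤s (NP.<⇒≤ qB')))) (sym (P≡pv (suc (suc p)) (suc (suc q)) (s≤s pA') (s≤s qB')))
                 (fin<fin (NP.<-≤-trans s<e (pv-s (suc p) (suc (suc q)) (s≤s pA') (s≤s qB')))))

  X-no-double-ascent : ∀ q → q ≡ B → P A (suc q) <∞ P (suc A) (suc q) → P (suc A) q <∞ P (suc A) (suc q) → ⊥
  X-no-double-ascent q refl h1 h2 with NP.⊔-sel (pv A (suc B)) (pv (suc A) B)
  ... | inj₁ e1 = NP.<-irrefl (trans (sym e1) (sym xm)) hn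
    where
    xm : pv (suc A) (suc B) ≡ pv A (suc B) ⊔ pv (suc A) B
    xm = fin-injective (trans (sym (P≡pv (suc A) (suc B) NP.≤-refl NP.≤-refl)) (trans xmax (cong₂ max∞ (P≡pv A (suc B) (NP.n≤1+n A) NP.≤-refl) (P≡pv (suc A) B NP.≤-refl (NP.n≤1+n B)))))
    hn : pv A (suc B) ℕ.< pv (suc A) (suc B)
    hn = fin<fin⁻ (subst₂ _<∞_ (P≡pv A (suc B) (NP.n≤1+n A) NP.≤-refl) (P≡pv (suc A) (suc B) NP.≤-refl NP.≤-refl) h1)
  ... | inj₂ e2 = NP.<-irrefl (trans (sym e2) (sym xm)) hw
    where
    xm : pv (suc A) (suc B) ≡ pv A (suc B) ⊔ pv (suc A) B
    xm = fin-injective (trans (sym (P≡pv (suc A) (suc B) NP.≤-refl NP.≤-refl)) (trans xmax (cong₂ max∞ (P≡pv A (suc B) (NP.n≤1+n A) NP.≤-refl) (P≡pv (suc A) B NP.≤-refl (NP.n≤1+n B)))))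
    hw : pv (suc A) B ℕ.< pv (suc A) (suc B)
    hw = fin<fin⁻ (subst₂ _<∞_ (P≡pv (suc A) B NP.≤-refl (NP.n≤1+n B)) (P≡pv (suc A) (suc B) NP.≤-refl NP.≤-refl) h2)

  e-cand-μ : ∀ p q → cell (suc p) (suc q) ∈ᵈ lam → q ℕ.+ A ≡ B ℕ.+ p → p ℕ.≤ A → q ℕ.≤ B →
    (∀ u → cand lam π u → cell (suc p) (suc q) ⊴ u) →
    P (suc p) q <∞ P (suc p) (suc q) → P p (suc q) <∞ P (suc p) (suc q) → cand mu ρ (cell (suc p) (suc (suc q)))
  e-cand-μ p q m d0 pA qB mn lw hn with p ℕ.≟ A
  ... | yes refl = ⊥-elim (X-no-double-ascent q (NP.+-cancelʳ-≡ p q B d0) hn lw)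
  ... | no ne = cX+1-cand-μ (cell (suc p) (suc q)) (diag⇒content≡cX p q d0) mn p (suc q) (∈ᵈ-downClosed lam pl X∈λ pA qB') ey lt
                  (<≤∞-trans hn (Pmono-e (suc p) (suc q)))
    where
    pA' : p ℕ.< A
    pA' = NP.≤∧≢⇒< pA ne
    qB' : q ℕ.< B
    qB' = diag-lt p q d0 pA'
    ey : c (cell (suc p) (suc (suc q))) ≡ c X + 1ℤ
    ey = content-e (suc p) (suc q) (diag⇒content≡cX p q d0)
    pvv = pv (suc p) (suc q)
    pev = pv (suc p) (suc (suc q))
    Rev : R (suc p) (suc (suc q)) ≡ fin pev
    Rev = trans (R≡P (suc p) (suc (suc q)) (cX+1≢cX (suc p) (suc (suc q)) ey)) (P≡pv (suc p) (suc (suc q)) (s≤s pA) (s≤s qB'))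
    hn' : pv p (suc q) ℕ.< pvv
    hn' = fin<fin⁻ (subst₂ _<∞_ (P≡pv p (suc q) (NP.≤-trans pA (NP.n≤1+n A)) (s≤s qB)) (P≡pv (suc p) (suc q) (s≤s pA) (s≤s qB)) hn)
    lw' : pv (suc p) q ℕ.< pvv
    lw' = P<P⇒pv<pv p q lw pA qB
    ve : pvv ℕ.≤ pev
    ve = pv-e (suc p) (suc q) (s≤s pA) (s≤s qB')
    lt : R (suc p) (suc q) <∞ R (suc p) (suc (suc q))
    lt = subst₂ _<∞_ (sym (R-toggle p q d0 pA')) (sym Rev)
           (fin<fin (NP.<-≤-trans (toggle<min _ _ _ (NP.⊔-lub hn' lw') (NP.⊓-glb ve (pv-s (suc p) (suc q) (s≤s pA') (s≤s (NP.<⇒≤ qB'))))) (NP.m⊓n≤m _ _)))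

  minCand-cX : ∀ p q → cell (suc p) (suc q) ∈ᵈ lam → c (cell (suc p) (suc q)) ≡ c X → IsMinCand lam π (cell (suc p) (suc q)) →
    ((val lam π (cell (suc p) (suc q)) ≡ val lam π (n (cell (suc p) (suc q)))) →
       cand mu ρ (n (cell (suc p) (suc q))) × ¬ cand mu ρ (e (cell (suc p) (suc q))))
    × ((val lam π (n (cell (suc p) (suc q))) <∞ val lam π (cell (suc p) (suc q))) → cand mu ρ (e (cell (suc p) (suc q))))
  minCand-cX p q m e (cv , mn) = (λ eqv → n-cand-μ p q m d0 pA qB mn lw eqv , λ ce → ¬e-cand-μ p q m d0 pA qB mn lw eqv (subst (cand mu ρ) (e-cell (suc p) (suc q)) ce)) ,
                             (λ hn → subst (cand mu ρ) (sym (e-cell (suc p) (suc q))) (e-cand-μ p q m d0 pA qB mn lw hn))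
    where
    d0 = content≡cX⇒diag p q e
    pA = diag∈λ⇒row≤A p q m d0
    qB : q ℕ.≤ B
    qB = NP.+-cancelʳ-≤ A q B (subst (ℕ._≤ B ℕ.+ A) (sym d0) (NP.+-monoʳ-≤ B pA))
    lw : P (suc p) q <∞ P (suc p) (suc q)
    lw = cand⇒w< {lam} {π} {cell (suc p) (suc q)} cv

  X-no-ascent-over-left : ∀ p q → suc p ≡ A → q ≡ B → pv (suc p) (suc q) ℕ.≤ pv (suc (suc p)) q → pv (suc (suc p)) q ℕ.< pv (suc (suc p)) (suc q) → ⊥
  X-no-ascent-over-left p q refl refl le lt = NP.<-irrefl (sym (trans xm (NP.m≤n⇒m⊔n≡n le))) lt
    where
    xm : pv (suc A) (suc B) ≡ pv A (suc B) ⊔ pv (suc A) B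
    xm = fin-injective (trans (sym (P≡pv (suc A) (suc B) NP.≤-refl NP.≤-refl)) (trans xmax (cong₂ max∞ (P≡pv A (suc B) (NP.n≤1+n A) NP.≤-refl) (P≡pv (suc A) B NP.≤-refl (NP.n≤1+n B)))))

  module _ (p q : ℕ) (m : cell (suc p) (suc q) ∈ᵈ lam) (e : c (cell (suc p) (suc q)) ≡ c X + 1ℤ) where
    cX+1-diag : q ℕ.+ A ≡ suc (B ℕ.+ p)
    cX+1-diag = content≡cX+1⇒diag p q e
    cX+1-row<A : p ℕ.< A
    cX+1-row<A = cX+1∈λ⇒row<A p q m e
    cX+1-col≤B : q ℕ.≤ B
    cX+1-col≤B = NP.+-cancelʳ-≤ A q B (subst (ℕ._≤ B ℕ.+ A) (sym cX+1-diag) (subst (ℕ._≤ B ℕ.+ A) (NP.+-suc B p) (NP.+-monoʳ-≤ B cX+1-row<A)))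
    cX+1-diag′ : q ℕ.+ A ≡ B ℕ.+ suc p
    cX+1-diag′ = trans cX+1-diag (sym (NP.+-suc B p))
    R≡pv-cX+1 : R (suc p) (suc q) ≡ fin (pv (suc p) (suc q))
    R≡pv-cX+1 = trans (R≡P (suc p) (suc q) (cX+1≢cX (suc p) (suc q) e)) (P≡pv (suc p) (suc q) (s≤s (NP.<⇒≤ cX+1-row<A)) (s≤s cX+1-col≤B))
    sw-content≢cX : c (cell (suc (suc p)) q) ≢ c X
    sw-content≢cX e0 = NP.<-irrefl E NP.≤-refl
      where
      E : suc (suc (B ℕ.+ p)) ≡ suc (suc (suc (B ℕ.+ p)))
      E = trans (sym (trans (NP.+-suc q A) (cong suc cX+1-diag))) (trans (content≡cX⇒ (suc (suc p)) q e0) (cong suc (trans (NP.+-suc B (suc p)) (cong suc (NP.+-suc B p)))))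
    R≡pv-sw : R (suc (suc p)) q ≡ fin (pv (suc (suc p)) q)
    R≡pv-sw = trans (R≡P (suc (suc p)) q sw-content≢cX) (P≡pv (suc (suc p)) q (s≤s cX+1-row<A) (NP.≤-trans cX+1-col≤B (NP.n≤1+n B)))

  w-cand-λ : ∀ p q → (m : cell (suc p) (suc q) ∈ᵈ lam) → (e : c (cell (suc p) (suc q)) ≡ c X + 1ℤ) →
    R (suc p) q <∞ R (suc p) (suc q) → pv (suc p) (suc q) ℕ.≤ pv (suc (suc p)) q → cand lam π (cell (suc p) q)
  w-cand-λ p zero m e lwR le = ⊥-elim (NP.n≮0 (NP.<-≤-trans (fin<fin⁻ (subst₂ _<∞_ (val-column0 mu ρ (suc p)) (R≡pv-cX+1 p zero m e) lwR)) le))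
  w-cand-λ p (suc q') m e lwR le with (pv p (suc q') ⊔ pv (suc p) q') ℕ.<? pv (suc p) (suc q')
  ... | yes lt = inj₁ (IsOuterContent⇒InO lam (cell (suc p) (suc q')) pl (∈ᵈ-downClosed lam pl X∈λ (NP.<⇒≤ (cX+1-row<A p (suc q') m e)) (NP.<⇒≤ (NP.<-≤-trans NP.≤-refl (cX+1-col≤B p (suc q') m e)))) (subst (IsOuterContent lam) (sym (diag⇒content≡cX p q' (NP.suc-injective (cX+1-diag p (suc q') m e)))) IsOuterContent-λ-cX) ,
                       subst₂ _<∞_ (sym (P≡pv (suc p) q' (s≤s (NP.<⇒≤ (cX+1-row<A p (suc q') m e))) (NP.≤-trans (NP.<⇒≤ (cX+1-col≤B p (suc q') m e)) (NP.n≤1+n B)))) (sym (P≡pv (suc p) (suc q') (s≤s (NP.<⇒≤ (cX+1-row<A p (suc q') m e))) (s≤s (NP.<⇒≤ (cX+1-col≤B p (suc q') m e)))))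
                         (fin<fin (NP.≤-<-trans (NP.m≤n⊔m _ _) lt)))
  ... | no nl = ⊥-elim (NP.<-irrefl (trans (toggle-maxAt _ _ _ Meq) mEq) tg<)
    where
    pA = cX+1-row<A p (suc q') m e
    d0 : q' ℕ.+ A ≡ B ℕ.+ p
    d0 = NP.suc-injective (cX+1-diag p (suc q') m e)
    qB' : q' ℕ.< B
    qB' = diag-lt p q' d0 pA
    Mle : pv p (suc q') ⊔ pv (suc p) q' ℕ.≤ pv (suc p) (suc q')
    Mle = NP.⊔-lub (pv-s p (suc q') (s≤s (NP.<⇒≤ pA)) (s≤s (NP.<⇒≤ qB'))) (pv-e (suc p) q' (s≤s (NP.<⇒≤ pA)) (s≤s (NP.<⇒≤ qB')))
    Meq : pv p (suc q') ⊔ pv (suc p) q' ≡ pv (suc p) (suc q')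
    Meq = NP.≤-antisym Mle (NP.≮⇒≥ nl)
    mEq : pv (suc p) (suc (suc q')) ⊓ pv (suc (suc p)) (suc q') ≡ pv (suc p) (suc (suc q'))
    mEq = NP.m≤n⇒m⊓n≡m le
    tg< : ((pv p (suc q') ⊔ pv (suc p) q') ℕ.+ (pv (suc p) (suc (suc q')) ⊓ pv (suc (suc p)) (suc q'))) ∸ pv (suc p) (suc q') ℕ.< pv (suc p) (suc (suc q'))
    tg< = fin<fin⁻ (subst₂ _<∞_ (R-toggle p q' d0 pA) (R≡pv-cX+1 p (suc q') m e) lwR)

  ¬s-cand-λ-A-case : ∀ p q → (m : cell (suc p) (suc q) ∈ᵈ lam) → (e : c (cell (suc p) (suc q)) ≡ c X + 1ℤ) →
    CandLowerBound (cell (suc p) (suc q)) → InA mu (cell (suc p) (suc q)) → cell (suc (suc p)) (suc (suc q)) ∈ᵈ mu →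
    c (cell (suc p) (suc q)) ≡ c (cell (suc (suc p)) (suc (suc q))) →
    R (suc (suc p)) (suc q) <∞ R (suc (suc p)) (suc (suc q)) →
    fin (pv (suc p) (suc q)) <∞ R (suc (suc p)) (suc (suc q)) → ⊥
  ¬s-cand-λ-A-case p q m e mn ia my' ceq lty ltv with <∞? (R (suc p) (suc (suc q))) (R (suc (suc p)) (suc (suc q)))
  ... | yes r = row<⇒⋬ (cell (suc p) (suc q)) (cell (suc (suc p)) (suc (suc q))) ceq (ℤ.+<+ NP.≤-refl)
                  (mn (cell (suc (suc p)) (suc (suc q))) (inj₂ (InA-sameContent mu (cell (suc p) (suc q)) (cell (suc (suc p)) (suc (suc q))) pm ia my' (sym ceq) , lty , r)))
  ... | no r = go (∃cand⊴ mu ρ pm R-mono-s p (suc q) mev ltev (IsAContent-suc mu (suc (suc q)) (suc p) acl))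
    where
    mev : cell (suc p) (suc (suc q)) ∈ᵈ mu
    mev = ∈ᵈ-downClosed mu pm my' (NP.n≤1+n p) NP.≤-refl
    ltev : R (suc p) (suc q) <∞ R (suc p) (suc (suc q))
    ltev = subst (_<∞ R (suc p) (suc (suc q))) (sym (R≡pv-cX+1 p q m e)) (<≤∞-trans ltv (≮∞⇒≥ r))
    acl : IsAContent mu (+ suc (suc q) - + suc (suc p))
    acl = subst (IsAContent mu) (cross≡⇒sub≡ (suc q) (suc p) (suc (suc q)) (suc (suc p)) (cong suc (NP.+-suc q (suc p)))) (InA⇒IsAContent mu (cell (suc p) (suc q)) pm ia)
    go : Σ Cell (λ u → cand mu ρ u × (u ⊴ cell (suc p) (suc (suc q)))) → ⊥
    go (u , cu , le2) = content<⇒⋬ (cell (suc p) (suc q)) u (ZP.<-≤-trans (cross<⇒sub< (suc q) (suc p) (suc (suc q)) (suc p) NP.≤-refl) (⊴⇒content≥ u (cell (suc p) (suc (suc q))) le2)) (mn u cu)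

  ¬s-cand-λ-above : ∀ p q → (m : cell (suc p) (suc q) ∈ᵈ lam) → (e : c (cell (suc p) (suc q)) ≡ c X + 1ℤ) →
    cand mu ρ (cell (suc p) (suc q)) → CandLowerBound (cell (suc p) (suc q)) → suc p ℕ.< A →
    pv (suc p) (suc q) ℕ.≤ pv (suc (suc p)) q → pv (suc (suc p)) q ℕ.< pv (suc (suc p)) (suc q) → ⊥
  ¬s-cand-λ-above p q m e cv mn spA le ltc = cls cv
    where
    d0z = cX+1-diag′ p q m e
    qB' : q ℕ.< B
    qB' = diag-lt (suc p) q d0z spA
    y' = cell (suc (suc p)) (suc (suc q))
    ey' : c y' ≡ c X + 1ℤ
    ey' = content-e (suc (suc p)) (suc q) (diag⇒content≡cX (suc p) q d0z)
    my' : y' ∈ᵈ mu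
    my' = ∈λ⇒∈μ (suc p) (suc q) (∈ᵈ-downClosed lam pl X∈λ (NP.<⇒≤ spA) qB') (cX+1≢cX (suc (suc p)) (suc (suc q)) ey')
    py = pv (suc (suc p)) (suc (suc q))
    Ry' : R (suc (suc p)) (suc (suc q)) ≡ fin py
    Ry' = trans (R≡P (suc (suc p)) (suc (suc q)) (cX+1≢cX (suc (suc p)) (suc (suc q)) ey')) (P≡pv (suc (suc p)) (suc (suc q)) (s≤s (NP.<⇒≤ spA)) (s≤s qB'))
    Mz : pv (suc p) (suc q) ⊔ pv (suc (suc p)) q ≡ pv (suc (suc p)) q
    Mz = NP.m≤n⇒m⊔n≡n le
    sy : pv (suc (suc p)) (suc q) ℕ.≤ py
    sy = pv-e (suc (suc p)) (suc q) (s≤s (NP.<⇒≤ spA)) (s≤s qB')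
    lty : R (suc (suc p)) (suc q) <∞ R (suc (suc p)) (suc (suc q))
    lty = subst₂ _<∞_ (sym (R-toggle (suc p) q d0z spA)) (sym Ry')
           (fin<fin (NP.<-≤-trans (toggle<min _ _ _ (subst (ℕ._< pv (suc (suc p)) (suc q)) (sym Mz) ltc) (NP.⊓-glb sy (pv-s (suc (suc p)) (suc q) (s≤s spA) (s≤s (NP.<⇒≤ qB'))))) (NP.m⊓n≤m _ _)))
    ceq : c (cell (suc p) (suc q)) ≡ c y'
    ceq = trans e (sym ey')
    ltv : fin (pv (suc p) (suc q)) <∞ R (suc (suc p)) (suc (suc q))
    ltv = subst (fin (pv (suc p) (suc q)) <∞_) (sym Ry') (fin<fin (NP.≤-<-trans le (NP.<-≤-trans ltc sy)))
    cls : cand mu ρ (cell (suc p) (suc q)) → ⊥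
    cls (inj₁ (io , _)) = row<⇒⋬ (cell (suc p) (suc q)) y' ceq (ℤ.+<+ NP.≤-refl) (mn y' (inj₁ (InO-sameContent mu (cell (suc p) (suc q)) y' pm io my' (sym ceq) , lty)))
    cls (inj₂ (ia , _ , _)) = ¬s-cand-λ-A-case p q m e mn ia my' ceq lty ltv

  ¬s-cand-λ : ∀ p q → (m : cell (suc p) (suc q) ∈ᵈ lam) → (e : c (cell (suc p) (suc q)) ≡ c X + 1ℤ) →
    cand mu ρ (cell (suc p) (suc q)) → CandLowerBound (cell (suc p) (suc q)) →
    pv (suc p) (suc q) ℕ.≤ pv (suc (suc p)) q → ¬ cand lam π (cell (suc (suc p)) (suc q))
  ¬s-cand-λ p q m e cv mn le cs = go (suc p ℕ.≟ A)
    where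
    pA = cX+1-row<A p q m e
    qB = cX+1-col≤B p q m e
    ltc : pv (suc (suc p)) q ℕ.< pv (suc (suc p)) (suc q)
    ltc = fin<fin⁻ (subst₂ _<∞_ (P≡pv (suc (suc p)) q (s≤s pA) (NP.≤-trans qB (NP.n≤1+n B))) (P≡pv (suc (suc p)) (suc q) (s≤s pA) (s≤s qB)) (cand⇒w< {lam} {π} {cell (suc (suc p)) (suc q)} cs))
    go : Dec (suc p ≡ A) → ⊥
    go (yes eA) = X-no-ascent-over-left p q eA (NP.+-cancelʳ-≡ A q B (trans (cX+1-diag p q m e) (trans (sym (NP.+-suc B p)) (cong (B ℕ.+_) eA)))) le ltc
    go (no ne) = ¬s-cand-λ-above p q m e cv mn (NP.≤∧≢⇒< pA ne) le ltc

  s-cand-λ : ∀ p q → (m : cell (suc p) (suc q) ∈ᵈ lam) → (e : c (cell (suc p) (suc q)) ≡ c X + 1ℤ) →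
    pv (suc (suc p)) q ℕ.< pv (suc p) (suc q) → cand lam π (cell (suc (suc p)) (suc q))
  s-cand-λ p q m e lt = inj₁ (IsOuterContent⇒InO lam (cell (suc (suc p)) (suc q)) pl (∈ᵈ-downClosed lam pl X∈λ pA qB) (subst (IsOuterContent lam) (sym (diag⇒content≡cX (suc p) q (cX+1-diag′ p q m e))) IsOuterContent-λ-cX) ,
                     subst₂ _<∞_ (sym (P≡pv (suc (suc p)) q (s≤s pA) (NP.≤-trans qB (NP.n≤1+n B)))) (sym (P≡pv (suc (suc p)) (suc q) (s≤s pA) (s≤s qB)))
                       (fin<fin (NP.<-≤-trans lt (pv-s (suc p) (suc q) (s≤s pA) (s≤s qB)))))
    where
    pA = cX+1-row<A p q m e
    qB = cX+1-col≤B p q m e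

  minCand-cX+1 : ∀ p q → cell (suc p) (suc q) ∈ᵈ lam → c (cell (suc p) (suc q)) ≡ c X + 1ℤ → IsMinCand mu ρ (cell (suc p) (suc q)) →
    ((val mu ρ (cell (suc p) (suc q)) ≤∞ val mu ρ (s (w (cell (suc p) (suc q))))) →
       cand lam π (w (cell (suc p) (suc q))) × ¬ cand lam π (s (cell (suc p) (suc q))))
    × ((val mu ρ (s (w (cell (suc p) (suc q)))) <∞ val mu ρ (cell (suc p) (suc q))) → cand lam π (s (cell (suc p) (suc q))))
  minCand-cX+1 p q m e (cv , mn) = (λ h → w-cand-λ p q m e lwR (h' h) , λ cs → ¬s-cand-λ p q m e cv mn (h' h) (subst (cand lam π) (s-cell (suc p) (suc q)) cs)) ,
                              (λ h → subst (cand lam π) (sym (s-cell (suc p) (suc q))) (s-cand-λ p q m e (h'' h)))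
    where
    lwR : R (suc p) q <∞ R (suc p) (suc q)
    lwR = cand⇒w< {mu} {ρ} {cell (suc p) (suc q)} cv
    h' : val mu ρ (cell (suc p) (suc q)) ≤∞ val mu ρ (s (w (cell (suc p) (suc q)))) → pv (suc p) (suc q) ℕ.≤ pv (suc (suc p)) q
    h' h = fin≤fin⁻ (subst₂ _≤∞_ (R≡pv-cX+1 p q m e) (trans (cong (val mu ρ) (s-cell (suc p) q)) (R≡pv-sw p q m e)) h)
    h'' : val mu ρ (s (w (cell (suc p) (suc q)))) <∞ val mu ρ (cell (suc p) (suc q)) → pv (suc (suc p)) q ℕ.< pv (suc p) (suc q)
    h'' h = fin<fin⁻ (subst₂ _<∞_ (trans (cong (val mu ρ) (s-cell (suc p) q)) (R≡pv-sw p q m e)) (R≡pv-cX+1 p q m e) h)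

mainTheorem17 :
  (lam : List ℕ) → IsPartition lam →
  (x : Cell) → OuterCorner lam x →
  (mu : List ℕ) → IsPartition mu →
  (∀ u → (u ∈ᵈ mu) ⇔ ((u ∈ᵈ lam) × (u ≢ x))) →
  (π : Filling) → IsRPPx lam x π →
  (v : Cell) → v ∈ᵈ lam →
    -- (i)
    ((c v ≢ c x - 1ℤ) → (c v ≢ c x) → (c v ≢ c x + 1ℤ) →
       cand lam π v ⇔ cand mu (ζ lam x π) v)
  × -- (ii)
    ((c v ≡ c x) → IsMinCand lam π v →
       ((val lam π v ≡ val lam π (n v)) →
          cand mu (ζ lam x π) (n v) × ¬ cand mu (ζ lam x π) (e v))
     × ((val lam π (n v) <∞ val lam π v) →
          cand mu (ζ lam x π) (e v)))
  × -- (iii)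
    ((c v ≡ c x + 1ℤ) → IsMinCand mu (ζ lam x π) v →
       ((val mu (ζ lam x π) v ≤∞ val mu (ζ lam x π) (s (w v))) →
          cand lam π (w v) × ¬ cand lam π (s v))
     × ((val mu (ζ lam x π) (s (w v)) <∞ val mu (ζ lam x π) v) →
          cand lam π (s v)))
  × -- (iv)
    ((c v ≡ c x - 1ℤ) →
       (cand lam π v → cand mu (ζ lam x π) v)
     × (IsMinCand mu (ζ lam x π) v → cand lam π v))
mainTheorem17 lam pl x ox mu pm H π (rpp , xmax) v vm
  with outerCorner-view lam x ox | ∈ᵈ-view lam v vm
... | (A , B , refl , hxA , hxS) | (p , q , refl , _) =
  cand-far⇔ p q vm , minCand-cX p q vm , minCand-cX+1 p q vm , cand-cX-1 p q vm
  where
  open CornerRemoval lam pl A B hxA hxS mu pm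
    (removeCorner-rowLen-corner lam mu A B H hxA) (removeCorner-rowLen lam mu A B H) π rpp xmax
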